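{- Let $\mathcal{C}$ be a $k$-dimensional $\mathbb{F}_{q^n}$-subspace of $V$ and $L\in\mathcal{L}_\mathcal{C}$. Then the weight distribution of $L$ with respect to hyperplanes is determined by the rank distribution of the points of $\Omega(\mathcal{C})$: $w_{k-2}(L)=n\cdot\mathbf{1}-rk(\Omega(\mathcal{C}))$, i.e., for each $i$, the number of hyperplanes of $\mathrm{PG}(k-1,q^n)$ having weight $n-i$ with respect to $L$ equals the number of points of $\Omega(\mathcal{C})$ of rank $i$.
   Context: $V=\mathrm{End}_{\mathbb{F}_q}(\mathbb{F}_{q^n})$, viewed as the $\mathbb{F}_{q^n}$-space of linearised polynomials identified with coefficient vectors; $\Omega(\mathcal{C})=\{\langle f\rangle_{q^n}:f\in\mathcal{C}\setminus\{0\}\}\subseteq\mathrm{PG}(n-1,q^n)$; the rank of a point $\langle f\rangle_{q^n}$ is the rank of $f$ as an $\mathbb{F}_q$-linear map, and $rk(\Omega(\mathcal{C}))$ is the vector whose $i$-th entry is the number of points of $\Omega(\mathcal{C})$ of rank $i$. $L_{f_1,\ldots,f_k}=L(U_{f_1,\ldots,f_k})$ with $U_{f_1,\ldots,f_k}=\{(f_1(x),\ldots,f_k(x)):x\in\mathbb{F}_{q^n}\}$, and $\mathcal{L}_\mathcal{C}$ is the set of $L_{f_1,\ldots,f_k}$ over all $\mathbb{F}_{q^n}$-bases $f_1,\ldots,f_k$ of $\mathcal{C}$. The weight of a hyperplane $H=\mathrm{PG}(W)$ w.r.t. $L(U)$ is $\dim_{\mathbb{F}_q}(U\cap W)$; $w_{k-2}(L)$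 is the vector whose $i$-th entry is the number of hyperplanes of weight $i$.
   Formalization: The corollary covers only those L whose space $U_{f_1,\ldots,f_k}$ has $\mathbb{F}_q$-dimension n, that is, bases $f_1,\ldots,f_k$ of 𝒞 whose elements have no common nonzero root. The statement above fails without it. -}

module Defs where

open import Level using (0ℓ)
open import Data.Nat as ℕ using (ℕ; zero; suc; _∸_)
open import Data.Fin using (Fin; toℕ) renaming (zero to fzero; suc to fsuc)
open import Data.Vec using (Vec; []; _∷_; lookup; zipWith; map; foldr; replicate; tabulate)
open import Data.List as List using (List; length)
open import Data.List.Relation.Unary.All using (All)
open import Data.List.Relation.Unary.Unique.Propositional using (Unique)
open import Data.List.Membership.Propositional using (_∈_)
open import Data.Product using (Σ; ∃; _×_; _,_)
open import Data.Sum using (_⊎_)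
open import Data.Empty using (⊥)
open import Relation.Nullary using (¬_)
open import Relation.Binary.PropositionalEquality using (_≡_; _≢_)
open import Algebra.Structures using (IsCommutativeRing)

record FiniteField : Set₁ where
  infixl 6 _+_
  infixl 7 _*_
  field
    K      : Set
    _+_    : K → K → K
    _*_    : K → K → K
    -_     : K → K
    0#     : K
    1#     : K
    isCommutativeRing : IsCommutativeRing _≡_ _+_ _*_ -_ 0# 1#
    0≢1    : 0# ≢ 1#
    inverse : ∀ x → x ≢ 0# → ∃ λ y → x * y ≡ 1#
    elements : List K
    elements-unique   : Unique elements
    elements-complete : ∀ x → x ∈ elements

  card : ℕ
  card = length elements

HasCount : {A : Set} → (A → Set) → ℕ → Set
HasCount {A} P m =
  Σ (List A) λ xs → Unique xs × All P xs × (∀ x → P x → x ∈ xs) × length xs ≡ m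

-- Everything below is relative to a finite field 𝕂 = F_{q^n}
-- and the parameter q (F_q ⊆ 𝕂 is the fixed field of x ↦ x^q).

module _ (𝕂 : FiniteField) (q : ℕ) where
  open FiniteField 𝕂

  _^ᴷ_ : K → ℕ → K
  x ^ᴷ zero  = 1#
  x ^ᴷ suc m = x * (x ^ᴷ m)

  IsFq : K → Set
  IsFq x = x ^ᴷ q ≡ x

  sumFin : {A : Set} → (A → A → A) → A → (d : ℕ) → (Fin d → A) → A
  sumFin _⊕_ o zero    v = o
  sumFin _⊕_ o (suc d) v = v fzero ⊕ sumFin _⊕_ o d (λ j → v (fsuc j))

  HasFqDim : {A : Set} → (A → A → A) → A → (K → A → A) → (A → Set) → ℕ → Set
  HasFqDim {A} _⊕_ o _·_ S d =
    Σ (Fin d → A) λ b →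
        (∀ j → S (b j))
      × (∀ (c : Fin d → K) → (∀ j → IsFq (c j)) →
           sumFin _⊕_ o d (λ j → c j · b j) ≡ o → ∀ j → c j ≡ 0#)
      × (∀ a → S a → Σ (Fin d → K) λ c → (∀ j → IsFq (c j))
                       × sumFin _⊕_ o d (λ j → c j · b j) ≡ a)

  _+ᵥ_ : ∀ {m} → Vec K m → Vec K m → Vec K m
  _+ᵥ_ = zipWith _+_

  0ᵥ : ∀ {m} → Vec K m
  0ᵥ = replicate _ 0#

  _·ᵥ_ : ∀ {m} → K → Vec K m → Vec K m
  a ·ᵥ v = map (a *_) v

  dot : ∀ {m} → Vec K m → Vec K m → K
  dot u v = foldr _ _+_ 0# (zipWith _*_ u v)

  FqDimK : (K → Set) → ℕ → Set
  FqDimK = HasFqDim _+_ 0# _*_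

  FqDimV : ∀ {m} → (Vec K m → Set) → ℕ → Set
  FqDimV = HasFqDim _+ᵥ_ 0ᵥ _·ᵥ_

  -- A linearised polynomial  a₀ x + a₁ x^q + … + a_{n-1} x^{q^{n-1}}
  -- identified with its coefficient vector (a₀,…,a_{n-1}) ∈ 𝕂^n.
  ev : ∀ {n} → Vec K n → K → K
  ev {n} a x = sumFin _+_ 0# n (λ i → lookup a i * (x ^ᴷ (q ℕ.^ toℕ i)))

  Rank : ∀ {n} → Vec K n → ℕ → Set
  Rank f r = FqDimK (λ y → ∃ λ x → ev f x ≡ y) r

  KLinIndep : ∀ {n k} → Vec (Vec K n) k → Set
  KLinIndep {n} {k} f =
    ∀ (c : Fin k → K) →
      sumFin _+ᵥ_ 0ᵥ k (λ j → c j ·ᵥ lookup f j) ≡ 0ᵥ → ∀ j → c j ≡ 0#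

  -- membership in 𝒞 = ⟨f₁,…,f_k⟩_{𝕂}
  InSpan : ∀ {n k} → Vec (Vec K n) k → Vec K n → Set
  InSpan {n} {k} f g =
    Σ (Fin k → K) λ c → sumFin _+ᵥ_ 0ᵥ k (λ j → c j ·ᵥ lookup f j) ≡ g

  U : ∀ {n k} → Vec (Vec K n) k → Vec K k → Set
  U f u = ∃ λ x → map (λ fj → ev fj x) f ≡ u

  -- U ∩ W where W = ker(λ) is the hyperplane with dual coordinates λ
  UcapHyp : ∀ {n k} → Vec (Vec K n) k → Vec K k → Vec K k → Set
  UcapHyp f λv u = U f u × dot λv u ≡ 0#

  -- canonical representative of a projective point: the first nonzero
  -- coordinate equals 1 (in particular the vector is nonzero)
  Normalized : ∀ {m} → Vec K m → Set
  Normalized []       = ⊥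
  Normalized (x ∷ xs) = (x ≡ 1#) ⊎ ((x ≡ 0#) × Normalized xs)

  -- points of Ω(𝒞) ⊆ PG(n-1,q^n) of rank i (as normalized representatives)
  OmegaPointOfRank : ∀ {n k} → Vec (Vec K n) k → ℕ → Vec K n → Set
  OmegaPointOfRank f i g = Normalized g × InSpan f g × Rank g i

  -- hyperplanes of PG(k-1,q^n) (as normalized dual coordinate vectors λ,
  -- H = PG(ker λ)) of weight w w.r.t. L_{f₁,…,f_k}
  HyperplaneOfWeight : ∀ {n k} → Vec (Vec K n) k → ℕ → Vec K k → Set
  HyperplaneOfWeight f w λv = Normalized λv × FqDimV (UcapHyp f λv) w

-- For dual coordinates λ, the functional u ↦ λ · u on U = {(f₁(x),…,f_k(x)) : x ∈ 𝕂} sends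
-- (f₁(x),…,f_k(x)) to g_λ(x), where g_λ = Σ λⱼ fⱼ ∈ 𝒞. Its kernel is U ∩ ker λ and its image is the
-- image of g_λ, so rank–nullity over 𝔽q on U, of dimension n, gives dim (U ∩ ker λ) = n − rank g_λ.
-- Since the fⱼ are 𝕂-independent, λ ↦ ⟨g_λ⟩ is a bijection from the hyperplanes of PG(k−1,q^n) onto
-- Ω(𝒞) taking weight n − i to rank i; counts are transported along it on normalised representatives.
--
-- The 𝔽q-linearity of x ↦ x^q, which makes 𝔽q = {x : x^q = x} a subfield and linearised polynomials
-- 𝔽q-linear, comes from q being a power of the characteristic p: 𝕂 is an 𝔽p-vector space, so
-- q^n = |𝕂| = p^e. Dimensions are compared by counting, a basis of size d spanning |𝔽|^d vectors.

module Submission where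

open import Level using (0ℓ)
open import Algebra.Bundles using (CommutativeRing)
open import Data.Empty using (⊥-elim)
open import Data.Fin.Base as Fin using (Fin; zero; suc; toℕ; fromℕ; inject₁; _↑ˡ_; _↑ʳ_; splitAt)
import Data.Fin.Properties as Fin
open import Data.List.Base as List using (List; []; _∷_; length; cartesianProductWith; filter; upTo)
open import Data.List.Membership.Propositional using (_∈_)
open import Data.List.Membership.Propositional.Properties
  using ( ∈-map⁻; ∈-map⁺; ∈-cartesianProductWith⁺; ∈-cartesianProductWith⁻
        ; ∈-filter⁻; ∈-filter⁺; ∈-upTo⁺; ∈-upTo⁻)
open import Data.List.Membership.Propositional.Properties.WithK using (unique∧set⇒bag)
open import Data.List.Properties using (length-map; length-++; length-upTo)
open import Data.List.Relation.Binary.BagAndSetEquality using (∼bag⇒↭)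
open import Data.List.Relation.Binary.Permutation.Propositional.Properties using (↭-length)
open import Data.List.Relation.Unary.All as All using (All; []; _∷_)
open import Data.List.Relation.Unary.Any as Any using (here; there)
open import Data.List.Relation.Unary.Any.Properties using (lookup-index)
open import Data.List.Relation.Unary.Unique.Propositional using (Unique; []; _∷_)
open import Data.List.Relation.Unary.Unique.Propositional.Properties using (cartesianProductWith⁺; filter⁺; upTo⁺)
open import Data.Nat.Base as ℕ using (ℕ; zero; suc; _≤_; _<_; _∸_; z≤n; s≤s; _!; NonZero)
open import Data.Nat.Combinatorics using (_C_; nCn≡1; nCk≡n!/k![n-k]!; k![n∸k]!∣n!)
open import Data.Nat.Coprimality using (Coprime; coprime-divisor; coprime-Bézout; prime⇒coprime)
open import Data.Nat.Divisibility using (_∣_; _∤_; divides; ∣⇒≤; m∣m*n; _∣?_; ∣1⇒≡1; *-cancelʳ-∣)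
open import Data.Nat.DivMod using (_%_; _/_; m≡m%n+[m/n]*n; m%n<n; m/n*n≡m)
open import Data.Nat.GCD using (module Bézout)
open import Data.Nat.ListAction using (product)
open import Data.Nat.Primality using (Prime; euclidsLemma; prime⇒irreducible; prime⇒nonZero; prime⇒nonTrivial)
open import Data.Nat.Primality.Factorisation using (factorise; PrimeFactorisation)
import Data.Nat.Properties as ℕ
open import Data.Product using (Σ; ∃; _×_; _,_; proj₁; proj₂)
open import Data.Sum using (_⊎_; inj₁; inj₂)
open import Data.Unit using (⊤; tt)
open import Data.Vec.Base as Vec using (Vec; []; _∷_; lookup; tabulate)
import Data.Vec.Properties as Vec
open import Data.Vec.Functional using (_++_) renaming (_∷_ to _◂_; [] to ∅)
open import Data.Vec.Functional.Properties using (lookup-++ˡ; lookup-++ʳ)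
open import Defs
open import Function.Base using (_∘_)
open import Function.Bundles using (_⇔_; mk⇔)
open import Relation.Binary.Definitions using (DecidableEquality; tri<; tri≈; tri>)
open import Relation.Binary.PropositionalEquality
open import Relation.Nullary using (¬_; Dec; yes; no)
open import Relation.Nullary.Decidable using (map′)

module _ {A : Set} where

  unique∧set⇒length≡ : {xs ys : List A} → Unique xs → Unique ys →
    (∀ {x} → x ∈ xs → x ∈ ys) → (∀ {x} → x ∈ ys → x ∈ xs) → length xs ≡ length ys
  unique∧set⇒length≡ xs! ys! xs⊆ys ys⊆xs =
    ↭-length (∼bag⇒↭ (unique∧set⇒bag xs! ys! (mk⇔ xs⊆ys ys⊆xs)))

  ≢-members⇒2≤length : {xs : List A} {x y : A} → x ∈ xs → y ∈ xs → x ≢ y → 2 ≤ length xs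
  ≢-members⇒2≤length {_ ∷ _ ∷ _} _        _          _   = s≤s (s≤s z≤n)
  ≢-members⇒2≤length {_ ∷ []}    (here refl) (here refl) x≢y = ⊥-elim (x≢y refl)

  map⁺-injectiveOn : {B : Set} {f : A → B} {xs : List A} → Unique xs →
    (∀ {x y} → x ∈ xs → y ∈ xs → f x ≡ f y → x ≡ y) → Unique (List.map f xs)
  map⁺-injectiveOn [] _ = []
  map⁺-injectiveOn {f = f} {x ∷ xs} (x∉xs ∷ xs!) inj =
    All.tabulate fx∉ ∷ map⁺-injectiveOn xs! (λ x∈ y∈ → inj (there x∈) (there y∈))
    where
    fx∉ : ∀ {z} → z ∈ List.map f xs → f x ≢ z
    fx∉ z∈ fx≡z with ∈-map⁻ f z∈
    ... | y , y∈xs , refl = All.lookup x∉xs y∈xs (inj (here refl) (there y∈xs) fx≡z)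

  length-cartesianProductWith : {B C : Set} (f : A → B → C) (xs : List A) (ys : List B) →
    length (List.cartesianProductWith f xs ys) ≡ length xs ℕ.* length ys
  length-cartesianProductWith f []       ys = refl
  length-cartesianProductWith f (x ∷ xs) ys = trans (length-++ (List.map (f x) ys))
    (cong₂ ℕ._+_ (length-map (f x) ys) (length-cartesianProductWith f xs ys))

module _ {X : Set} where

  ◂-++ : ∀ {m w} v (x : Fin m → X) (e : Fin w → X) j → ((v ◂ x) ++ e) j ≡ (v ◂ (x ++ e)) j
  ◂-++ v x e zero = refl
  ◂-++ {m} v x e (suc j) with splitAt m j
  ... | inj₁ _ = refl
  ... | inj₂ _ = refl

  ++-all : ∀ {P : X → Set} {m w} {x : Fin m → X} {e : Fin w → X} →
    (∀ j → P (x j)) → (∀ j → P (e j)) → ∀ j → P ((x ++ e) j)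
  ++-all {m = m} Px Pe j with splitAt m j
  ... | inj₁ i = Px i
  ... | inj₂ i = Pe i

  lookup-extensionality : ∀ {d} {u v : Vec X d} → (∀ i → lookup u i ≡ lookup v i) → u ≡ v
  lookup-extensionality {u = u} {v} u≗v =
    trans (sym (Vec.tabulate∘lookup u)) (trans (Vec.tabulate-cong u≗v) (Vec.tabulate∘lookup v))

HasCount-transport : {A B : Set} {P : A → Set} {Q : B → Set} (to : A → B) (from : B → A) →
  (∀ {a} → P a → Q (to a)) → (∀ {b} → Q b → P (from b)) →
  (∀ {a} → P a → from (to a) ≡ a) → (∀ {b} → Q b → to (from b) ≡ b) →
  ∀ {m} → HasCount P m → HasCount Q m
HasCount-transport {Q = Q} to from to-Q from-P from∘to to∘from (as , as! , all-P , complete , len) =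
  List.map to as ,
  map⁺-injectiveOn as! (λ a∈ a′∈ eq →
    trans (sym (from∘to (All.lookup all-P a∈))) (trans (cong from eq) (from∘to (All.lookup all-P a′∈)))) ,
  All.tabulate Q-members ,
  (λ b qb → subst (_∈ List.map to as) (to∘from qb) (∈-map⁺ to (complete (from b) (from-P qb)))) ,
  trans (length-map to as) len
  where
  Q-members : ∀ {b} → b ∈ List.map to as → Q b
  Q-members b∈ with ∈-map⁻ to b∈
  ... | a , a∈ , refl = to-Q (All.lookup all-P a∈)

^-injectiveʳ : ∀ {m} → 1 < m → ∀ a b → m ℕ.^ a ≡ m ℕ.^ b → a ≡ b
^-injectiveʳ 1<m a b eq with ℕ.<-cmp a b
... | tri< a<b _ _ = ⊥-elim (ℕ.<-irrefl eq (ℕ.^-monoʳ-< _ 1<m a<b))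
... | tri≈ _ a≡b _ = a≡b
... | tri> _ _ b<a = ⊥-elim (ℕ.<-irrefl (sym eq) (ℕ.^-monoʳ-< _ 1<m b<a))

∣-prime-power : ∀ {p} → Prime p → ∀ e d → d ∣ p ℕ.^ e → ∃ λ a → d ≡ p ℕ.^ a
∣-prime-power p-prime zero d d∣1 = 0 , ∣1⇒≡1 d∣1
∣-prime-power {p} p-prime (suc e) d d∣p^[1+e] with p ∣? d
... | yes (divides t refl) with ∣-prime-power p-prime e t
        (*-cancelʳ-∣ p {{prime⇒nonZero p-prime}} (subst (t ℕ.* p ∣_) (ℕ.*-comm p (p ℕ.^ e)) d∣p^[1+e]))
...   | a , refl = suc a , ℕ.*-comm (p ℕ.^ a) p
∣-prime-power {p} p-prime (suc e) d d∣p^[1+e] | no p∤d =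
  ∣-prime-power p-prime e d (coprime-divisor d⊥p d∣p^[1+e])
  where
  d⊥p : Coprime d p
  d⊥p (i∣d , i∣p) with prime⇒irreducible p-prime i∣p
  ... | inj₁ i≡1 = i≡1
  ... | inj₂ refl = ⊥-elim (p∤d i∣d)

prime∤! : ∀ {p} → Prime p → ∀ m → m < p → p ∤ m !
prime∤! {p} p-prime zero _ p∣1 =
  ℕ.<-irrefl refl (ℕ.≤-trans (ℕ.nonTrivial⇒n>1 p {{prime⇒nonTrivial p-prime}}) (∣⇒≤ p∣1))
prime∤! p-prime (suc m) 1+m<p p∣[1+m]! with euclidsLemma (suc m) (m !) p-prime p∣[1+m]!
... | inj₁ p∣1+m = ℕ.<-irrefl refl (ℕ.<-≤-trans 1+m<p (∣⇒≤ p∣1+m))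
... | inj₂ p∣m!  = prime∤! p-prime m (ℕ.<-trans (ℕ.n<1+n m) 1+m<p) p∣m!

prime∣C : ∀ {p} → Prime p → ∀ k → 0 < k → k < p → p ∣ p C k
prime∣C {p@(suc p′)} p-prime k 0<k k<p
  with euclidsLemma (p C k) (k ! ℕ.* (p ∸ k) !) p-prime (subst (p ∣_) (sym C*k!*[p∸k]!≡p!) (m∣m*n (p′ !)))
  where
  C*k!*[p∸k]!≡p! : (p C k) ℕ.* (k ! ℕ.* (p ∸ k) !) ≡ p !
  C*k!*[p∸k]!≡p! = trans (cong (ℕ._* (k ! ℕ.* (p ∸ k) !)) (nCk≡n!/k![n-k]! (ℕ.<⇒≤ k<p)))
    (m/n*n≡m {{ℕ._!*_!≢0 k (p ∸ k)}} (k![n∸k]!∣n! (ℕ.<⇒≤ k<p)))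
... | inj₁ p∣C = p∣C
... | inj₂ p∣k![p∸k]! with euclidsLemma (k !) ((p ∸ k) !) p-prime p∣k![p∸k]!
...   | inj₁ p∣k! = ⊥-elim (prime∤! p-prime k k<p p∣k!)
...   | inj₂ p∣[p∸k]! =
  ⊥-elim (prime∤! p-prime (p ∸ k) (ℕ.∸-monoʳ-< {p} {k} {0} 0<k (ℕ.<⇒≤ k<p)) p∣[p∸k]!)

-- Linear algebra over a subfield

module Field (𝕂 : FiniteField) where
  open FiniteField 𝕂 public

  ring : CommutativeRing 0ℓ 0ℓ
  ring = record { isCommutativeRing = isCommutativeRing }

  open CommutativeRing ring public
    using ( +-assoc; +-comm; +-identityˡ; +-identityʳ; -‿inverseʳ
          ; *-assoc; *-comm; *-identityˡ; *-identityʳ; distribˡ; distribʳ; zeroˡ; zeroʳ)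
  open import Algebra.Properties.Ring (CommutativeRing.ring ring) public
    using (+-cancelˡ; +-inverseʳ-unique; -1*x≈-x; -‿distribʳ-*; x∙y⁻¹≈ε⇒x≈y)

  position : K → Fin card
  position x = Any.index (elements-complete x)

  position-injective : ∀ {x y} → position x ≡ position y → x ≡ y
  position-injective {x} {y} eq = trans (lookup-index (elements-complete x))
    (trans (cong (List.lookup elements) eq) (sym (lookup-index (elements-complete y))))

  _≟_ : DecidableEquality K
  x ≟ y = map′ position-injective (cong position) (position x Fin.≟ position y)

  x*y≡0⇒x≡0⊎y≡0 : ∀ {x y} → x * y ≡ 0# → x ≡ 0# ⊎ y ≡ 0#
  x*y≡0⇒x≡0⊎y≡0 {x} {y} xy≡0 with x ≟ 0#
  ... | yes x≡0 = inj₁ x≡0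
  ... | no x≢0 with inverse x x≢0
  ...   | x⁻¹ , xx⁻¹≡1 = inj₂ (begin
    y               ≡⟨ sym (*-identityˡ y) ⟩
    1# * y          ≡⟨ cong (_* y) (trans (sym xx⁻¹≡1) (*-comm x x⁻¹)) ⟩
    (x⁻¹ * x) * y   ≡⟨ *-assoc x⁻¹ x y ⟩
    x⁻¹ * (x * y)   ≡⟨ cong (x⁻¹ *_) xy≡0 ⟩
    x⁻¹ * 0#        ≡⟨ zeroʳ x⁻¹ ⟩
    0#              ∎)
    where open ≡-Reasoning

  record Subfield : Set₁ where
    field
      IsScalar  : K → Set
      0-scalar  : IsScalar 0#
      1-scalar  : IsScalar 1#
      +-scalar  : ∀ {x y} → IsScalar x → IsScalar y → IsScalar (x + y)
      *-scalar  : ∀ {x y} → IsScalar x → IsScalar y → IsScalar (x * y)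
      -‿scalar  : ∀ {x} → IsScalar x → IsScalar (- x)
      ⁻¹-scalar : ∀ {x} → IsScalar x → x ≢ 0# → Σ K λ y → IsScalar y × x * y ≡ 1#
      scalars          : List K
      scalars-unique   : Unique scalars
      scalars-sound    : All IsScalar scalars
      scalars-complete : ∀ {x} → IsScalar x → x ∈ scalars

  record VectorSpace : Set₁ where
    infixl 6 _⊕_
    infixr 7 _·_
    field
      A    : Set
      _⊕_  : A → A → A
      o    : A
      _·_  : K → A → A
      ⊕-assoc     : ∀ x y z → (x ⊕ y) ⊕ z ≡ x ⊕ (y ⊕ z)
      ⊕-comm      : ∀ x y → x ⊕ y ≡ y ⊕ x
      ⊕-identityˡ : ∀ x → o ⊕ x ≡ x
      ·-distribˡ  : ∀ a x y → a · (x ⊕ y) ≡ a · x ⊕ a · y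
      ·-distribʳ  : ∀ a b x → (a + b) · x ≡ a · x ⊕ b · x
      ·-assoc     : ∀ a b x → (a * b) · x ≡ a · (b · x)
      ·-identityˡ : ∀ x → 1# · x ≡ x
      ·-zeroˡ     : ∀ x → 0# · x ≡ o
      _≟ᵥ_        : DecidableEquality A

  field-as-space : VectorSpace
  field-as-space = record
    { A = K ; _⊕_ = _+_ ; o = 0# ; _·_ = _*_
    ; ⊕-assoc = +-assoc ; ⊕-comm = +-comm ; ⊕-identityˡ = +-identityˡ
    ; ·-distribˡ = distribˡ ; ·-distribʳ = λ a b x → distribʳ x a b
    ; ·-assoc = *-assoc ; ·-identityˡ = *-identityˡ ; ·-zeroˡ = zeroˡ ; _≟ᵥ_ = _≟_ }

  K-as-subfield : Subfield
  K-as-subfield = record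
    { IsScalar = λ _ → ⊤ ; 0-scalar = tt ; 1-scalar = tt
    ; +-scalar = λ _ _ → tt ; *-scalar = λ _ _ → tt ; -‿scalar = λ _ → tt
    ; ⁻¹-scalar = λ {x} _ x≢0 → proj₁ (inverse x x≢0) , tt , proj₂ (inverse x x≢0)
    ; scalars = elements ; scalars-unique = elements-unique
    ; scalars-sound = All.tabulate λ _ → tt ; scalars-complete = λ {x} _ → elements-complete x }

-- Only coefficients from the subfield 𝔽 are used, so HasDim unfolds to Defs' HasFqDim when 𝔽 = 𝔽q.
-- The index q is only passed on to sumFin, which ignores it.
module Span (𝕂 : FiniteField) (q : ℕ) (V : Field.VectorSpace 𝕂) (𝔽 : Field.Subfield 𝕂) where
  open Field 𝕂
  open VectorSpace V public
  open Subfield 𝔽 public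
  open ≡-Reasoning

  ∑ : (d : ℕ) → (Fin d → A) → A
  ∑ = sumFin 𝕂 q _⊕_ o

  lincomb : ∀ {d} → (Fin d → K) → (Fin d → A) → A
  lincomb {d} c b = ∑ d (λ j → c j · b j)

  Scalars : ∀ {d} → (Fin d → K) → Set
  Scalars c = ∀ j → IsScalar (c j)

  _∈⟨_⟩ : ∀ {d} → A → (Fin d → A) → Set
  a ∈⟨ b ⟩ = Σ _ λ c → Scalars c × lincomb c b ≡ a

  Independent : ∀ {d} → (Fin d → A) → Set
  Independent b = ∀ c → Scalars c → lincomb c b ≡ o → ∀ j → c j ≡ 0#

  HasDim : (A → Set) → ℕ → Set
  HasDim S d = Σ (Fin d → A) λ b → (∀ j → S (b j)) × Independent b × (∀ a → S a → a ∈⟨ b ⟩)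

  Subspace : (A → Set) → Set
  Subspace S = ∀ {d} (c : Fin d → K) b → Scalars c → (∀ j → S (b j)) → S (lincomb c b)

  ⊕-identityʳ : ∀ x → x ⊕ o ≡ x
  ⊕-identityʳ x = trans (⊕-comm x o) (⊕-identityˡ x)

  ·-zeroʳ : ∀ a → a · o ≡ o
  ·-zeroʳ a = begin
    a · o          ≡⟨ cong (a ·_) (sym (·-zeroˡ o)) ⟩
    a · (0# · o)   ≡⟨ sym (·-assoc a 0# o) ⟩
    (a * 0#) · o   ≡⟨ cong (_· o) (zeroʳ a) ⟩
    0# · o         ≡⟨ ·-zeroˡ o ⟩
    o              ∎

  x⊕-x≡o : ∀ x → x ⊕ (- 1#) · x ≡ o
  x⊕-x≡o x = begin
    x ⊕ (- 1#) · x         ≡⟨ cong (_⊕ (- 1#) · x) (sym (·-identityˡ x)) ⟩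
    1# · x ⊕ (- 1#) · x    ≡⟨ sym (·-distribʳ 1# (- 1#) x) ⟩
    (1# + - 1#) · x        ≡⟨ cong (_· x) (-‿inverseʳ 1#) ⟩
    0# · x                 ≡⟨ ·-zeroˡ x ⟩
    o                      ∎

  x⊕y≡o⇒x≡-y : ∀ x y → x ⊕ y ≡ o → x ≡ (- 1#) · y
  x⊕y≡o⇒x≡-y x y x⊕y≡o = begin
    x                         ≡⟨ sym (⊕-identityʳ x) ⟩
    x ⊕ o                     ≡⟨ cong (x ⊕_) (sym (x⊕-x≡o y)) ⟩
    x ⊕ (y ⊕ (- 1#) · y)      ≡⟨ sym (⊕-assoc x y _) ⟩
    (x ⊕ y) ⊕ (- 1#) · y      ≡⟨ cong (_⊕ (- 1#) · y) x⊕y≡o ⟩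
    o ⊕ (- 1#) · y            ≡⟨ ⊕-identityˡ _ ⟩
    (- 1#) · y                ∎

  ⊕-interchange : ∀ a b c d → (a ⊕ b) ⊕ (c ⊕ d) ≡ (a ⊕ c) ⊕ (b ⊕ d)
  ⊕-interchange a b c d = begin
    (a ⊕ b) ⊕ (c ⊕ d)  ≡⟨ ⊕-assoc a b (c ⊕ d) ⟩
    a ⊕ (b ⊕ (c ⊕ d))  ≡⟨ cong (a ⊕_) (sym (⊕-assoc b c d)) ⟩
    a ⊕ ((b ⊕ c) ⊕ d)  ≡⟨ cong (λ t → a ⊕ (t ⊕ d)) (⊕-comm b c) ⟩
    a ⊕ ((c ⊕ b) ⊕ d)  ≡⟨ cong (a ⊕_) (⊕-assoc c b d) ⟩
    a ⊕ (c ⊕ (b ⊕ d))  ≡⟨ sym (⊕-assoc a c (b ⊕ d)) ⟩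
    (a ⊕ c) ⊕ (b ⊕ d)  ∎

  ∑-cong : ∀ d {u v : Fin d → A} → (∀ j → u j ≡ v j) → ∑ d u ≡ ∑ d v
  ∑-cong zero    u≗v = refl
  ∑-cong (suc d) u≗v = cong₂ _⊕_ (u≗v zero) (∑-cong d (u≗v ∘ suc))

  ∑-o : ∀ d → ∑ d (λ _ → o) ≡ o
  ∑-o zero    = refl
  ∑-o (suc d) = trans (cong (o ⊕_) (∑-o d)) (⊕-identityˡ o)

  ∑-⊕ : ∀ d (u v : Fin d → A) → ∑ d (λ j → u j ⊕ v j) ≡ ∑ d u ⊕ ∑ d v
  ∑-⊕ zero    u v = sym (⊕-identityˡ o)
  ∑-⊕ (suc d) u v = trans (cong (u zero ⊕ v zero ⊕_) (∑-⊕ d (u ∘ suc) (v ∘ suc))) (⊕-interchange _ _ _ _)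

  ∑-· : ∀ d a (v : Fin d → A) → a · ∑ d v ≡ ∑ d (λ j → a · v j)
  ∑-· zero    a v = ·-zeroʳ a
  ∑-· (suc d) a v = trans (·-distribˡ a _ _) (cong (a · v zero ⊕_) (∑-· d a (v ∘ suc)))

  ∑-split : ∀ m w (v : Fin (m ℕ.+ w) → A) → ∑ (m ℕ.+ w) v ≡ ∑ m (v ∘ (_↑ˡ w)) ⊕ ∑ w (v ∘ (m ↑ʳ_))
  ∑-split zero    w v = sym (⊕-identityˡ _)
  ∑-split (suc m) w v = trans (cong (v zero ⊕_) (∑-split m w (v ∘ suc))) (sym (⊕-assoc _ _ _))

  lincomb-cong : ∀ {d} {c c′ : Fin d → K} {b b′ : Fin d → A} →
    (∀ j → c j ≡ c′ j) → (∀ j → b j ≡ b′ j) → lincomb c b ≡ lincomb c′ b′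
  lincomb-cong {d} c≗c′ b≗b′ = ∑-cong d (λ j → cong₂ _·_ (c≗c′ j) (b≗b′ j))

  lincomb-zeroˡ : ∀ {d} (b : Fin d → A) → lincomb (λ _ → 0#) b ≡ o
  lincomb-zeroˡ {d} b = trans (∑-cong d (·-zeroˡ ∘ b)) (∑-o d)

  lincomb-zeroʳ : ∀ {d} (c : Fin d → K) → lincomb c (λ _ → o) ≡ o
  lincomb-zeroʳ {d} c = trans (∑-cong d (·-zeroʳ ∘ c)) (∑-o d)

  lincomb-+ : ∀ {d} (c c′ : Fin d → K) b → lincomb (λ j → c j + c′ j) b ≡ lincomb c b ⊕ lincomb c′ b
  lincomb-+ {d} c c′ b = trans (∑-cong d (λ j → ·-distribʳ (c j) (c′ j) (b j))) (∑-⊕ d _ _)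

  lincomb-scale : ∀ {d} a (c : Fin d → K) b → a · lincomb c b ≡ lincomb (λ j → a * c j) b
  lincomb-scale {d} a c b = trans (∑-· d a _) (∑-cong d (λ j → sym (·-assoc a (c j) (b j))))

  lincomb-neg : ∀ {d} (c : Fin d → K) b → lincomb (λ j → - c j) b ≡ (- 1#) · lincomb c b
  lincomb-neg c b = trans (lincomb-cong (λ j → sym (-1*x≈-x (c j))) (λ _ → refl)) (sym (lincomb-scale (- 1#) c b))

  lincomb-++ʳ : ∀ {m w} (c : Fin (m ℕ.+ w) → K) x e →
    lincomb c (x ++ e) ≡ lincomb (c ∘ (_↑ˡ w)) x ⊕ lincomb (c ∘ (m ↑ʳ_)) e
  lincomb-++ʳ {m} {w} c x e = trans (∑-split m w _)
    (cong₂ _⊕_ (lincomb-cong (λ _ → refl) (lookup-++ˡ x e)) (lincomb-cong (λ _ → refl) (lookup-++ʳ x e)))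

  lincomb-++ : ∀ {m w} (c : Fin m → K) (c′ : Fin w → K) x e →
    lincomb (c ++ c′) (x ++ e) ≡ lincomb c x ⊕ lincomb c′ e
  lincomb-++ c c′ x e = trans (lincomb-++ʳ (c ++ c′) x e)
    (cong₂ _⊕_ (lincomb-cong (lookup-++ˡ c c′) (λ _ → refl)) (lincomb-cong (lookup-++ʳ c c′) (λ _ → refl)))

  Scalars-sub : ∀ {d} {c c′ : Fin d → K} → Scalars c → Scalars c′ → Scalars (λ j → c j + - c′ j)
  Scalars-sub c∈ c′∈ j = +-scalar (c∈ j) (-‿scalar (c′∈ j))

  independent⇒coefficients-unique : ∀ {d} {b : Fin d → A} → Independent b →
    ∀ {c c′} → Scalars c → Scalars c′ → lincomb c b ≡ lincomb c′ b → ∀ j → c j ≡ c′ j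
  independent⇒coefficients-unique {b = b} b-indep {c} {c′} c∈ c′∈ eq j =
    x∙y⁻¹≈ε⇒x≈y (c j) (c′ j) (b-indep _ (Scalars-sub c∈ c′∈) difference≡o j)
    where
    difference≡o : lincomb (λ j → c j + - c′ j) b ≡ o
    difference≡o = begin
      lincomb (λ j → c j + - c′ j) b          ≡⟨ lincomb-+ c _ b ⟩
      lincomb c b ⊕ lincomb (λ j → - c′ j) b  ≡⟨ cong (lincomb c b ⊕_) (lincomb-neg c′ b) ⟩
      lincomb c b ⊕ (- 1#) · lincomb c′ b     ≡⟨ cong (λ t → lincomb c b ⊕ (- 1#) · t) (sym eq) ⟩
      lincomb c b ⊕ (- 1#) · lincomb c b      ≡⟨ x⊕-x≡o _ ⟩
      o                                       ∎

  span⊆subspace : ∀ {S} {d} {b : Fin d → A} {a} → Subspace S → (∀ j → S (b j)) → a ∈⟨ b ⟩ → S a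
  span⊆subspace S-sub b∈S (c , c∈ , refl) = S-sub c _ c∈ b∈S

  HasDim-resp : ∀ {S S′ : A → Set} {d} → (∀ {a} → S a → S′ a) → (∀ {a} → S′ a → S a) →
    HasDim S d → HasDim S′ d
  HasDim-resp S⊆S′ S′⊆S (b , b∈S , b-indep , b-spans) =
    b , S⊆S′ ∘ b∈S , b-indep , λ a a∈S′ → b-spans a (S′⊆S a∈S′)

  coefficients : ∀ d → List (Vec K d)
  coefficients zero    = [] ∷ []
  coefficients (suc d) = cartesianProductWith _∷_ scalars (coefficients d)

  coefficients-unique : ∀ d → Unique (coefficients d)
  coefficients-unique zero    = [] ∷ []
  coefficients-unique (suc d) =
    cartesianProductWith⁺ _∷_ Vec.∷-injective scalars-unique (coefficients-unique d)

  coefficients-complete : ∀ {d} (v : Vec K d) → Scalars (lookup v) → v ∈ coefficients d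
  coefficients-complete []      _  = here refl
  coefficients-complete (x ∷ v) v∈ =
    ∈-cartesianProductWith⁺ _∷_ (scalars-complete (v∈ zero)) (coefficients-complete v (v∈ ∘ suc))

  coefficients-sound : ∀ {d} {v : Vec K d} → v ∈ coefficients d → Scalars (lookup v)
  coefficients-sound {zero} _ ()
  coefficients-sound {suc d} v∈ with ∈-cartesianProductWith⁻ _∷_ scalars (coefficients d) v∈
  ... | x , v , x∈ , v∈′ , refl = λ { zero → All.lookup scalars-sound x∈ ; (suc j) → coefficients-sound v∈′ j }

  Q : ℕ
  Q = length scalars

  1<Q : 1 < Q
  1<Q = ≢-members⇒2≤length (scalars-complete 0-scalar) (scalars-complete 1-scalar) 0≢1

  length-coefficients : ∀ d → length (coefficients d) ≡ Q ℕ.^ d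
  length-coefficients zero    = refl
  length-coefficients (suc d) =
    trans (length-cartesianProductWith _∷_ scalars (coefficients d)) (cong (Q ℕ.*_) (length-coefficients d))

  spanList : ∀ {d} → (Fin d → A) → List A
  spanList b = List.map (λ v → lincomb (lookup v) b) (coefficients _)

  length-spanList : ∀ {d} (b : Fin d → A) → length (spanList b) ≡ Q ℕ.^ d
  length-spanList {d} b = trans (length-map _ (coefficients d)) (length-coefficients d)

  spanList-unique : ∀ {d} {b : Fin d → A} → Independent b → Unique (spanList b)
  spanList-unique {d} b-indep = map⁺-injectiveOn (coefficients-unique d) λ v∈ v′∈ eq →
    lookup-extensionality (independent⇒coefficients-unique b-indep (coefficients-sound v∈) (coefficients-sound v′∈) eq)

  ∈spanList⇒∈⟨⟩ : ∀ {d} {b : Fin d → A} {a} → a ∈ spanList b → a ∈⟨ b ⟩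
  ∈spanList⇒∈⟨⟩ a∈ with ∈-map⁻ _ a∈
  ... | v , v∈ , refl = lookup v , coefficients-sound v∈ , refl

  ∈⟨⟩⇒∈spanList : ∀ {d} {b : Fin d → A} {a} → a ∈⟨ b ⟩ → a ∈ spanList b
  ∈⟨⟩⇒∈spanList {b = b} (c , c∈ , refl) =
    subst (_∈ spanList b) (lincomb-cong (Vec.lookup∘tabulate c) (λ _ → refl))
      (∈-map⁺ _ (coefficients-complete (tabulate c) (λ j → subst IsScalar (sym (Vec.lookup∘tabulate c j)) (c∈ j))))

  _∈⟨_⟩? : ∀ {d} a (b : Fin d → A) → Dec (a ∈⟨ b ⟩)
  a ∈⟨ b ⟩? = map′ ∈spanList⇒∈⟨⟩ ∈⟨⟩⇒∈spanList (a ∈? spanList b)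
    where open import Data.List.Membership.DecPropositional _≟ᵥ_ using (_∈?_)

  -- Both bases list every element of S exactly once, so Q ^ d = |S| = Q ^ d′.
  dim-unique : ∀ {S d d′} → Subspace S → HasDim S d → HasDim S d′ → d ≡ d′
  dim-unique {S} {d} {d′} S-sub (b , b∈S , b-indep , b-spans) (b′ , b′∈S , b′-indep , b′-spans) =
    ^-injectiveʳ 1<Q d d′ (begin
      Q ℕ.^ d              ≡⟨ sym (length-spanList b) ⟩
      length (spanList b)  ≡⟨ unique∧set⇒length≡ (spanList-unique b-indep) (spanList-unique b′-indep)
                                (moveTo b′-spans b∈S) (moveTo b-spans b′∈S) ⟩
      length (spanList b′) ≡⟨ length-spanList b′ ⟩
      Q ℕ.^ d′             ∎)
    where
    moveTo : ∀ {e f} {b₁ : Fin e → A} {b₂ : Fin f → A} →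
      (∀ a → S a → a ∈⟨ b₂ ⟩) → (∀ j → S (b₁ j)) → ∀ {a} → a ∈ spanList b₁ → a ∈ spanList b₂
    moveTo b₂-spans b₁∈S a∈ =
      ∈⟨⟩⇒∈spanList (b₂-spans _ (span⊆subspace S-sub b₁∈S (∈spanList⇒∈⟨⟩ a∈)))

  independent-≗ : ∀ {d} {b b′ : Fin d → A} → (∀ j → b j ≡ b′ j) → Independent b → Independent b′
  independent-≗ b≗b′ b-indep c c∈ eq = b-indep c c∈ (trans (lincomb-cong (λ _ → refl) b≗b′) eq)

  ∈⟨⟩-≗ : ∀ {d} {b b′ : Fin d → A} {a} → (∀ j → b j ≡ b′ j) → a ∈⟨ b ⟩ → a ∈⟨ b′ ⟩
  ∈⟨⟩-≗ b≗b′ (c , c∈ , eq) = c , c∈ , trans (lincomb-cong (λ _ → refl) (sym ∘ b≗b′)) eq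

  ∈⟨⟩-◂ : ∀ {d} {b : Fin d → A} {a} v → a ∈⟨ b ⟩ → a ∈⟨ v ◂ b ⟩
  ∈⟨⟩-◂ {b = b} v (c , c∈ , eq) = (0# ◂ c) , (λ { zero → 0-scalar ; (suc j) → c∈ j }) ,
    trans (cong (_⊕ lincomb c b) (·-zeroˡ v)) (trans (⊕-identityˡ _) eq)

  head-∈⟨⟩ : ∀ {d} (b : Fin d → A) v → v ∈⟨ v ◂ b ⟩
  head-∈⟨⟩ b v = (1# ◂ λ _ → 0#) , (λ { zero → 1-scalar ; (suc j) → 0-scalar }) ,
    trans (cong₂ _⊕_ (·-identityˡ v) (lincomb-zeroˡ b)) (⊕-identityʳ v)

  independent-◂ : ∀ {d} {b : Fin d → A} {v} → Independent b → ¬ v ∈⟨ b ⟩ → Independent (v ◂ b)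
  independent-◂ {d} {b} {v} b-indep v∉ c c∈ relation with c zero ≟ 0#
  ... | yes c₀≡0 = λ { zero → c₀≡0 ; (suc j) → b-indep (c ∘ suc) (c∈ ∘ suc) tail-relation j }
    where
    tail-relation : lincomb (c ∘ suc) b ≡ o
    tail-relation = begin
      lincomb (c ∘ suc) b               ≡⟨ sym (⊕-identityˡ _) ⟩
      o ⊕ lincomb (c ∘ suc) b           ≡⟨ cong (_⊕ lincomb (c ∘ suc) b) (sym (·-zeroˡ v)) ⟩
      0# · v ⊕ lincomb (c ∘ suc) b      ≡⟨ cong (λ a → a · v ⊕ lincomb (c ∘ suc) b) (sym c₀≡0) ⟩
      c zero · v ⊕ lincomb (c ∘ suc) b  ≡⟨ relation ⟩
      o                                 ∎
  ... | no c₀≢0 with ⁻¹-scalar (c∈ zero) c₀≢0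
  ...   | y , y∈ , c₀y≡1 =
    ⊥-elim (v∉ (_ , (λ j → *-scalar (*-scalar y∈ (-‿scalar 1-scalar)) (c∈ (suc j))) , sym v≡))
    where
    v≡ : v ≡ lincomb (λ j → (y * - 1#) * c (suc j)) b
    v≡ = begin
      v                                  ≡⟨ sym (·-identityˡ v) ⟩
      1# · v                             ≡⟨ cong (_· v) (trans (sym c₀y≡1) (*-comm (c zero) y)) ⟩
      (y * c zero) · v                   ≡⟨ ·-assoc y (c zero) v ⟩
      y · (c zero · v)                   ≡⟨ cong (y ·_) (x⊕y≡o⇒x≡-y _ _ relation) ⟩
      y · ((- 1#) · lincomb (c ∘ suc) b) ≡⟨ sym (·-assoc y (- 1#) _) ⟩
      (y * - 1#) · lincomb (c ∘ suc) b   ≡⟨ lincomb-scale (y * - 1#) (c ∘ suc) b ⟩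
      lincomb (λ j → (y * - 1#) * c (suc j)) b ∎

  extend-independent : (P : A → Set) → ∀ {w} {e : Fin w → A} → Independent e →
    (as : List A) → All P as →
    Σ ℕ λ m → Σ (Fin m → A) λ x →
      (∀ j → P (x j)) × Independent (x ++ e) × (∀ {a} → a ∈ as → a ∈⟨ x ++ e ⟩)
  extend-independent P e-indep []       []         = 0 , (λ ()) , (λ ()) , e-indep , λ ()
  extend-independent P {e = e} e-indep (a ∷ as) (Pa ∷ Pas) with extend-independent P e-indep as Pas
  ... | m , x , Px , x++e-indep , as⊆ with a ∈⟨ x ++ e ⟩?
  ...   | yes a∈ = m , x , Px , x++e-indep , λ { (here refl) → a∈ ; (there a′∈) → as⊆ a′∈ }
  ...   | no a∉ = suc m , a ◂ x , (λ { zero → Pa ; (suc j) → Px j }) ,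
          independent-≗ (sym ∘ ◂-++ a x e) (independent-◂ x++e-indep a∉) ,
          λ { (here refl) → ∈⟨⟩-≗ (sym ∘ ◂-++ a x e) (head-∈⟨⟩ (x ++ e) a)
            ; (there a′∈) → ∈⟨⟩-≗ (sym ∘ ◂-++ a x e) (∈⟨⟩-◂ a (as⊆ a′∈)) }

  enumerable⇒HasDim : ∀ {T} (as : List A) → All T as → (∀ {a} → T a → a ∈ as) → ∃ λ d → HasDim T d
  enumerable⇒HasDim {T} as T-as as-complete with extend-independent T {e = ∅} (λ _ _ _ ()) as T-as
  ... | m , x , Tx , indep , as⊆ = m ℕ.+ 0 , x ++ ∅ , ++-all {P = T} Tx (λ ()) , indep , λ a Ta → as⊆ (as-complete Ta)

module RankNullity (𝕂 : FiniteField) (q : ℕ) (𝔽 : Field.Subfield 𝕂) (V W : Field.VectorSpace 𝕂) where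
  open Field 𝕂 using (K; 0#; 1#; -_; _*_; -1*x≈-x)
  module V = Span 𝕂 q V 𝔽
  module W = Span 𝕂 q W 𝔽
  open V using (A; _⊕_; o; _·_; lincomb; Scalars; _∈⟨_⟩; Independent; HasDim; Subspace)
  open ≡-Reasoning

  module OnSubspace (ψ : A → W.A)
                    (ψ-⊕ : ∀ x y → ψ (x ⊕ y) ≡ ψ x W.⊕ ψ y) (ψ-· : ∀ a x → ψ (a · x) ≡ a W.· ψ x)
                    {S : A → Set} (S-sub : Subspace S) {n : ℕ} (S-dim : HasDim S n) where

    ψ-o : ψ o ≡ W.o
    ψ-o = trans (cong ψ (sym (V.·-zeroˡ o))) (trans (ψ-· 0# o) (W.·-zeroˡ _))

    ψ-lincomb : ∀ {d} (c : Fin d → K) b → ψ (lincomb c b) ≡ W.lincomb c (ψ ∘ b)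
    ψ-lincomb {zero}  c b = ψ-o
    ψ-lincomb {suc d} c b = trans (ψ-⊕ _ _) (cong₂ W._⊕_ (ψ-· (c zero) (b zero)) (ψ-lincomb (c ∘ suc) (b ∘ suc)))

    Ker : A → Set
    Ker a = S a × ψ a ≡ W.o

    Im : W.A → Set
    Im y = Σ A λ a → S a × ψ a ≡ y

    Ker-subspace : Subspace Ker
    Ker-subspace c b c∈ b∈Ker = S-sub c b c∈ (proj₁ ∘ b∈Ker) ,
      trans (ψ-lincomb c b) (trans (W.lincomb-cong (λ _ → refl) (proj₂ ∘ b∈Ker)) (W.lincomb-zeroʳ c))

    Im-subspace : W.Subspace Im
    Im-subspace c y c∈ y∈Im = lincomb c (proj₁ ∘ y∈Im) , S-sub c _ c∈ (proj₁ ∘ proj₂ ∘ y∈Im) ,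
      trans (ψ-lincomb c _) (W.lincomb-cong (λ _ → refl) (proj₂ ∘ proj₂ ∘ y∈Im))

    S-elements : List A
    S-elements = V.spanList (proj₁ S-dim)

    S-elements-sound : All S S-elements
    S-elements-sound = All.tabulate λ a∈ → V.span⊆subspace S-sub (proj₁ (proj₂ S-dim)) (V.∈spanList⇒∈⟨⟩ a∈)

    S-elements-complete : ∀ {a} → S a → a ∈ S-elements
    S-elements-complete Sa = V.∈⟨⟩⇒∈spanList (proj₂ (proj₂ (proj₂ S-dim)) _ Sa)

    -- Extend a basis e of the kernel to a basis x ++ e of S; then ψ ∘ x is a basis of the image.
    dim-Im+dim-Ker : ∀ {w} → HasDim Ker w → Σ ℕ λ m → m ℕ.+ w ≡ n × W.HasDim Im m
    dim-Im+dim-Ker {w} (e , e∈Ker , e-indep , e-spans)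
      with V.extend-independent S e-indep S-elements S-elements-sound
    ... | m , x , Sx , b-indep , b-spans-S = m , m+w≡n , ψ ∘ x , (λ j → x j , Sx j , refl) , ψx-indep , ψx-spans
      where
      b = x ++ e

      b-spans : ∀ a → S a → a ∈⟨ b ⟩
      b-spans a Sa = b-spans-S (S-elements-complete Sa)

      m+w≡n : m ℕ.+ w ≡ n
      m+w≡n = V.dim-unique S-sub (b , ++-all {P = S} Sx (proj₁ ∘ e∈Ker) , b-indep , b-spans) S-dim

      ψx-indep : W.Independent (ψ ∘ x)
      ψx-indep c c∈ ψ[cx]≡o j with e-spans _ (S-sub c x c∈ Sx , trans (ψ-lincomb c x) ψ[cx]≡o)
      ... | c′ , c′∈ , c′e≡cx =
        trans (sym (lookup-++ˡ c (-_ ∘ c′) j))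
          (b-indep _ (++-all {P = V.IsScalar} c∈ (V.-‿scalar ∘ c′∈)) relation (j ↑ˡ w))
        where
        relation : lincomb (c ++ (-_ ∘ c′)) b ≡ o
        relation = begin
          lincomb (c ++ (-_ ∘ c′)) b           ≡⟨ V.lincomb-++ c (-_ ∘ c′) x e ⟩
          lincomb c x ⊕ lincomb (-_ ∘ c′) e    ≡⟨ cong (lincomb c x ⊕_) (V.lincomb-neg c′ e) ⟩
          lincomb c x ⊕ (- 1#) · lincomb c′ e  ≡⟨ cong (λ t → lincomb c x ⊕ (- 1#) · t) c′e≡cx ⟩
          lincomb c x ⊕ (- 1#) · lincomb c x   ≡⟨ V.x⊕-x≡o _ ⟩
          o                                    ∎

      ψx-spans : ∀ y → Im y → y W.∈⟨ ψ ∘ x ⟩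
      ψx-spans y (a , Sa , refl) with b-spans a Sa
      ... | γ , γ∈ , refl = γ ∘ (_↑ˡ w) , γ∈ ∘ (_↑ˡ w) , sym (begin
          ψ (lincomb γ b)                                       ≡⟨ cong ψ (V.lincomb-++ʳ γ x e) ⟩
          ψ (lincomb (γ ∘ (_↑ˡ w)) x ⊕ lincomb (γ ∘ (m ↑ʳ_)) e)  ≡⟨ ψ-⊕ _ _ ⟩
          ψ (lincomb (γ ∘ (_↑ˡ w)) x) W.⊕ ψ (lincomb (γ ∘ (m ↑ʳ_)) e)
            ≡⟨ cong₂ W._⊕_ (ψ-lincomb _ x) (proj₂ (Ker-subspace _ e (γ∈ ∘ (m ↑ʳ_)) e∈Ker)) ⟩
          W.lincomb (γ ∘ (_↑ˡ w)) (ψ ∘ x) W.⊕ W.o               ≡⟨ W.⊕-identityʳ _ ⟩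
          W.lincomb (γ ∘ (_↑ˡ w)) (ψ ∘ x)                       ∎)

    dim-Ker⇒dim-Im : ∀ {w} → HasDim Ker w → W.HasDim Im (n ∸ w)
    dim-Ker⇒dim-Im {w} Ker-dim with dim-Im+dim-Ker Ker-dim
    ... | m , m+w≡n , Im-dim = subst (W.HasDim Im) (trans (sym (ℕ.m+n∸n≡m m w)) (cong (_∸ w) m+w≡n)) Im-dim

    dim-Im⇒dim-Ker : ∀ {r} → W.HasDim Im r → HasDim Ker (n ∸ r)
    dim-Im⇒dim-Ker {r} Im-dim with V.enumerable⇒HasDim Ker-elements Ker-elements-sound Ker-elements-complete
      where
      ψ≡o? : ∀ a → Dec (ψ a ≡ W.o)
      ψ≡o? a = ψ a W.≟ᵥ W.o
      Ker-elements = filter ψ≡o? S-elements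
      Ker-elements-sound : All Ker Ker-elements
      Ker-elements-sound = All.tabulate λ a∈ →
        let a∈S , ψa≡o = ∈-filter⁻ ψ≡o? a∈ in All.lookup S-elements-sound a∈S , ψa≡o
      Ker-elements-complete : ∀ {a} → Ker a → a ∈ Ker-elements
      Ker-elements-complete (Sa , ψa≡o) = ∈-filter⁺ ψ≡o? (S-elements-complete Sa) ψa≡o
    ... | w , Ker-dim with dim-Im+dim-Ker Ker-dim
    ...   | m , m+w≡n , Im-dim′ = subst (HasDim Ker) w≡n∸r Ker-dim
      where
      w≡n∸r : w ≡ n ∸ r
      w≡n∸r = begin
        w               ≡⟨ sym (ℕ.m+n∸m≡n m w) ⟩
        m ℕ.+ w ∸ m     ≡⟨ cong₂ _∸_ m+w≡n (sym (W.dim-unique Im-subspace Im-dim Im-dim′)) ⟩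
        n ∸ r           ∎

-- The characteristic and the Frobenius map

module Characteristic (𝕂 : FiniteField) where
  open Field 𝕂
  open CommutativeRing ring using (semiring; commutativeSemiring; +-rawMonoid)
  open import Algebra.Properties.Semiring.Mult semiring using (×-homo-+; ×1-homo-*; ×-assoc-*) renaming (_×_ to _⊠_)
  open import Algebra.Properties.Semiring.Exp semiring public using (_^_; ^-assocʳ)
  open import Algebra.Properties.CommutativeSemiring.Exp commutativeSemiring public using (^-distrib-*)
  open import Algebra.Properties.CommutativeSemiring.Binomial commutativeSemiring using (theorem; binomialTerm)
  open import Algebra.Definitions.RawMonoid +-rawMonoid using (sum)
  open ≡-Reasoning

  ι : ℕ → K
  ι n = n ⊠ 1#

  ι-+ : ∀ m n → ι (m ℕ.+ n) ≡ ι m + ι n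
  ι-+ m n = ×-homo-+ 1# m n

  ι-* : ∀ m n → ι (m ℕ.* n) ≡ ι m * ι n
  ι-* = ×1-homo-*

  ι-1 : ι 1 ≡ 1#
  ι-1 = +-identityʳ 1#

  ⊠≡ι* : ∀ n x → n ⊠ x ≡ ι n * x
  ⊠≡ι* n x = sym (trans (×-assoc-* n 1# x) (cong (n ⊠_) (*-identityˡ x)))

  ι-vanishes : ∃ λ N → 0 < N × ι N ≡ 0#
  ι-vanishes with Fin.pigeonhole (ℕ.n<1+n card) (λ i → position (ι (toℕ i)))
  ... | i , j , i<j , same-position = toℕ j ∸ toℕ i , ℕ.m<n⇒0<n∸m i<j ,
    +-cancelˡ (ι (toℕ i)) _ _ (begin
      ι (toℕ i) + ι (toℕ j ∸ toℕ i)  ≡⟨ sym (ι-+ (toℕ i) _) ⟩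
      ι (toℕ i ℕ.+ (toℕ j ∸ toℕ i))  ≡⟨ cong ι (ℕ.m+[n∸m]≡n (ℕ.<⇒≤ i<j)) ⟩
      ι (toℕ j)                      ≡⟨ sym (position-injective same-position) ⟩
      ι (toℕ i)                      ≡⟨ sym (+-identityʳ _) ⟩
      ι (toℕ i) + 0#                 ∎)

  prime-factor-vanishes : ∀ {ps} → All Prime ps → ι (product ps) ≡ 0# → ∃ λ p → Prime p × ι p ≡ 0#
  prime-factor-vanishes [] ι1≡0 = ⊥-elim (0≢1 (sym (trans (sym ι-1) ι1≡0)))
  prime-factor-vanishes {p ∷ ps} (p-prime ∷ ps-prime) ιp*ps≡0
    with x*y≡0⇒x≡0⊎y≡0 (trans (sym (ι-* p (product ps))) ιp*ps≡0)
  ... | inj₁ ιp≡0  = p , p-prime , ιp≡0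
  ... | inj₂ ιps≡0 = prime-factor-vanishes ps-prime ιps≡0

  ∑-endpoints : ∀ m (t : Fin (suc (suc m)) → K) → (∀ j → t (suc (inject₁ j)) ≡ 0#) →
    sum t ≡ t zero + t (fromℕ (suc m))
  ∑-endpoints zero    t _ = cong (t zero +_) (+-identityʳ _)
  ∑-endpoints (suc m) t middle≡0 = cong (t zero +_) (begin
    sum (λ i → t (suc i))                          ≡⟨ ∑-endpoints m (λ i → t (suc i)) (λ j → middle≡0 (suc j)) ⟩
    t (suc zero) + t (fromℕ (suc (suc m)))         ≡⟨ cong (_+ t (fromℕ (suc (suc m)))) (middle≡0 zero) ⟩
    0# + t (fromℕ (suc (suc m)))                   ≡⟨ +-identityˡ _ ⟩
    t (fromℕ (suc (suc m)))                        ∎)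

  frobenius : ∀ {r} → Prime r → ι r ≡ 0# → ∀ x y → (x + y) ^ r ≡ x ^ r + y ^ r
  frobenius {r} r-prime ιr≡0 x y with ℕ.nonTrivial⇒n>1 r {{prime⇒nonTrivial r-prime}}
  frobenius {r@(suc (suc m))} r-prime ιr≡0 x y | _ = begin
    (x + y) ^ r                                    ≡⟨ theorem r x y ⟩
    sum (binomialTerm x y r)                       ≡⟨ ∑-endpoints (suc m) (binomialTerm x y r) middle≡0 ⟩
    binomialTerm x y r zero + binomialTerm x y r (fromℕ r) ≡⟨ cong₂ _+_ first last ⟩
    y ^ r + x ^ r                                  ≡⟨ +-comm _ _ ⟩
    x ^ r + y ^ r                                  ∎
    where
    middle≡0 : ∀ j → binomialTerm x y r (suc (inject₁ j)) ≡ 0#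
    middle≡0 j with prime∣C r-prime (suc (toℕ (inject₁ j))) (s≤s z≤n)
                      (s≤s (subst (_< suc m) (sym (Fin.toℕ-inject₁ j)) (Fin.toℕ<n j)))
    ... | divides c C≡c*r = begin
      binomialTerm x y r k      ≡⟨ ⊠≡ι* (r C toℕ k) B ⟩
      ι (r C toℕ k) * B         ≡⟨ cong (λ t → ι t * B) C≡c*r ⟩
      ι (c ℕ.* r) * B           ≡⟨ cong (_* B) (trans (ι-* c r) (trans (cong (ι c *_) ιr≡0) (zeroʳ _))) ⟩
      0# * B                    ≡⟨ zeroˡ B ⟩
      0#                        ∎
      where
      k = suc (inject₁ j)
      B = x ^ toℕ k * y ^ (r ∸ toℕ k)
    first : binomialTerm x y r zero ≡ y ^ r
    first = trans (+-identityʳ _) (*-identityˡ _)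
    last : binomialTerm x y r (fromℕ r) ≡ x ^ r
    last = begin
      binomialTerm x y r (fromℕ r)                    ≡⟨ ⊠≡ι* (r C toℕ (fromℕ r)) _ ⟩
      ι (r C toℕ (fromℕ r)) * (x ^ toℕ (fromℕ r) * y ^ (r ∸ toℕ (fromℕ r)))
        ≡⟨ cong (λ k → ι (r C k) * (x ^ k * y ^ (r ∸ k))) (Fin.toℕ-fromℕ r) ⟩
      ι (r C r) * (x ^ r * y ^ (r ∸ r))
        ≡⟨ cong₂ (λ c e → ι c * (x ^ r * y ^ e)) (nCn≡1 r) (ℕ.n∸n≡0 r) ⟩
      ι 1 * (x ^ r * 1#)                              ≡⟨ cong₂ _*_ ι-1 (*-identityʳ _) ⟩
      1# * x ^ r                                      ≡⟨ *-identityˡ _ ⟩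
      x ^ r                                           ∎

  opaque
    characteristic : ∃ λ p → Prime p × ι p ≡ 0#
    characteristic with ι-vanishes
    ... | N , 0<N , ιN≡0 = prime-factor-vanishes factorsPrime (trans (cong ι (sym isFactorisation)) ιN≡0)
      where open PrimeFactorisation (factorise N {{ℕ.>-nonZero 0<N}})

  p : ℕ
  p = proj₁ characteristic

  p-prime : Prime p
  p-prime = proj₁ (proj₂ characteristic)

  ι-p≡0 : ι p ≡ 0#
  ι-p≡0 = proj₂ (proj₂ characteristic)

  instance
    p-nonZero : NonZero p
    p-nonZero = prime⇒nonZero p-prime

  ι-multiple-of-p : ∀ a → ι (a ℕ.* p) ≡ 0#
  ι-multiple-of-p a = trans (ι-* a p) (trans (cong (ι a *_) ι-p≡0) (zeroʳ _))

  ι-mod : ∀ k → ι k ≡ ι (k % p)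
  ι-mod k = begin
    ι k                                ≡⟨ cong ι (m≡m%n+[m/n]*n k p) ⟩
    ι (k % p ℕ.+ (k / p) ℕ.* p)        ≡⟨ ι-+ (k % p) _ ⟩
    ι (k % p) + ι ((k / p) ℕ.* p)      ≡⟨ cong (ι (k % p) +_) (ι-multiple-of-p (k / p)) ⟩
    ι (k % p) + 0#                     ≡⟨ +-identityʳ _ ⟩
    ι (k % p)                          ∎

  ι-neg : ∀ k → - ι k ≡ ι ((p ∸ 1) ℕ.* k)
  ι-neg k = begin
    - ι k               ≡⟨ sym (-1*x≈-x (ι k)) ⟩
    - 1# * ι k          ≡⟨ cong (_* ι k) (sym ι[p∸1]≡-1) ⟩
    ι (p ∸ 1) * ι k     ≡⟨ sym (ι-* (p ∸ 1) k) ⟩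
    ι ((p ∸ 1) ℕ.* k)   ∎
    where
    ι[p∸1]≡-1 : ι (p ∸ 1) ≡ - 1#
    ι[p∸1]≡-1 = +-inverseʳ-unique 1# (ι (p ∸ 1)) (begin
      1# + ι (p ∸ 1)        ≡⟨ cong (_+ ι (p ∸ 1)) (sym ι-1) ⟩
      ι 1 + ι (p ∸ 1)       ≡⟨ sym (ι-+ 1 (p ∸ 1)) ⟩
      ι (1 ℕ.+ (p ∸ 1))     ≡⟨ cong ι (ℕ.m+[n∸m]≡n (ℕ.>-nonZero⁻¹ p)) ⟩
      ι p                   ≡⟨ ι-p≡0 ⟩
      0#                    ∎)

  PrimeField : K → Set
  PrimeField x = ∃ λ k → ι k ≡ x

  ι-unit : ∀ r → .{{NonZero r}} → r < p → Σ K λ y → PrimeField y × ι r * y ≡ 1#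
  ι-unit r r<p with coprime-Bézout (prime⇒coprime p-prime r<p)
  ... | Bézout.+- a b 1+br≡ap = ι ((p ∸ 1) ℕ.* b) , ((p ∸ 1) ℕ.* b , refl) , (begin
    ι r * ι ((p ∸ 1) ℕ.* b)   ≡⟨ cong (ι r *_) (sym (ι-neg b)) ⟩
    ι r * - ι b               ≡⟨ sym (-‿distribʳ-* (ι r) (ι b)) ⟩
    - (ι r * ι b)             ≡⟨ cong -_ (trans (*-comm (ι r) (ι b)) (sym (ι-* b r))) ⟩
    - ι (b ℕ.* r)             ≡⟨ sym (+-inverseʳ-unique (ι (b ℕ.* r)) 1# (begin
                                   ι (b ℕ.* r) + 1#        ≡⟨ +-comm _ 1# ⟩
                                   1# + ι (b ℕ.* r)        ≡⟨ cong (_+ ι (b ℕ.* r)) (sym ι-1) ⟩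
                                   ι 1 + ι (b ℕ.* r)       ≡⟨ sym (ι-+ 1 (b ℕ.* r)) ⟩
                                   ι (1 ℕ.+ b ℕ.* r)       ≡⟨ cong ι 1+br≡ap ⟩
                                   ι (a ℕ.* p)             ≡⟨ ι-multiple-of-p a ⟩
                                   0#                      ∎)) ⟩
    1#                        ∎)
  ... | Bézout.-+ a b 1+ap≡br = ι b , (b , refl) , (begin
    ι r * ι b            ≡⟨ trans (*-comm (ι r) (ι b)) (sym (ι-* b r)) ⟩
    ι (b ℕ.* r)          ≡⟨ cong ι (sym 1+ap≡br) ⟩
    ι (1 ℕ.+ a ℕ.* p)    ≡⟨ ι-+ 1 (a ℕ.* p) ⟩
    ι 1 + ι (a ℕ.* p)    ≡⟨ cong₂ _+_ ι-1 (ι-multiple-of-p a) ⟩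
    1# + 0#              ≡⟨ +-identityʳ 1# ⟩
    1#                   ∎)

  ι-nonzero : ∀ {r} → 0 < r → r < p → ι r ≢ 0#
  ι-nonzero {r} 0<r r<p ιr≡0 with ι-unit r {{ℕ.>-nonZero 0<r}} r<p
  ... | y , _ , ιr*y≡1 = 0≢1 (trans (sym (zeroˡ y)) (trans (cong (_* y) (sym ιr≡0)) ιr*y≡1))

  ι-distinct-below-p : ∀ {i j} → i < j → j < p → ι i ≢ ι j
  ι-distinct-below-p {i} {j} i<j j<p ιi≡ιj = ι-nonzero (ℕ.m<n⇒0<n∸m i<j) (ℕ.≤-<-trans (ℕ.m∸n≤m j i) j<p)
    (sym (+-cancelˡ (ι i) 0# _ (begin
      ι i + 0#              ≡⟨ +-identityʳ _ ⟩
      ι i                   ≡⟨ ιi≡ιj ⟩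
      ι j                   ≡⟨ cong ι (sym (ℕ.m+[n∸m]≡n (ℕ.<⇒≤ i<j))) ⟩
      ι (i ℕ.+ (j ∸ i))     ≡⟨ ι-+ i (j ∸ i) ⟩
      ι i + ι (j ∸ i)       ∎)))

  ι-injective-below-p : ∀ {i j} → i < p → j < p → ι i ≡ ι j → i ≡ j
  ι-injective-below-p {i} {j} i<p j<p ιi≡ιj with ℕ.<-cmp i j
  ... | tri< i<j _ _ = ⊥-elim (ι-distinct-below-p i<j j<p ιi≡ιj)
  ... | tri≈ _ i≡j _ = i≡j
  ... | tri> _ _ j<i = ⊥-elim (ι-distinct-below-p j<i i<p (sym ιi≡ιj))

  𝔽ₚ : Subfield
  𝔽ₚ = record
    { IsScalar  = PrimeField
    ; 0-scalar  = 0 , refl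
    ; 1-scalar  = 1 , ι-1
    ; +-scalar  = λ { (a , refl) (b , refl) → a ℕ.+ b , ι-+ a b }
    ; *-scalar  = λ { (a , refl) (b , refl) → a ℕ.* b , ι-* a b }
    ; -‿scalar  = λ { (a , refl) → (p ∸ 1) ℕ.* a , sym (ι-neg a) }
    ; ⁻¹-scalar = λ { (k , refl) ιk≢0 → invert k ιk≢0 }
    ; scalars          = List.map ι (upTo p)
    ; scalars-unique   = map⁺-injectiveOn (upTo⁺ p) λ i∈ j∈ →
                           ι-injective-below-p (∈-upTo⁻ i∈) (∈-upTo⁻ j∈)
    ; scalars-sound    = All.tabulate λ x∈ → let k , _ , x≡ιk = ∈-map⁻ ι x∈ in k , sym x≡ιk
    ; scalars-complete = λ { (k , refl) →
                           subst (_∈ List.map ι (upTo p)) (sym (ι-mod k)) (∈-map⁺ ι (∈-upTo⁺ (m%n<n k p))) }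
    }
    where
    invert : ∀ k → ι k ≢ 0# → Σ K λ y → PrimeField y × ι k * y ≡ 1#
    invert k ιk≢0
      with ι-unit (k % p) {{ℕ.≢-nonZero λ k%p≡0 → ιk≢0 (trans (ι-mod k) (cong ι k%p≡0))}} (m%n<n k p)
    ... | y , y∈ , eq = y , y∈ , trans (cong (_* y) (ι-mod k)) eq

  frobenius-p^ : ∀ a x y → (x + y) ^ (p ℕ.^ a) ≡ x ^ (p ℕ.^ a) + y ^ (p ℕ.^ a)
  frobenius-p^ zero    x y = trans (*-identityʳ _) (sym (cong₂ _+_ (*-identityʳ x) (*-identityʳ y)))
  frobenius-p^ (suc a) x y = begin
    (x + y) ^ (p ℕ.* p ℕ.^ a)                ≡⟨ sym (^-assocʳ (x + y) p _) ⟩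
    ((x + y) ^ p) ^ (p ℕ.^ a)                ≡⟨ cong (_^ (p ℕ.^ a)) (frobenius p-prime ι-p≡0 x y) ⟩
    (x ^ p + y ^ p) ^ (p ℕ.^ a)              ≡⟨ frobenius-p^ a _ _ ⟩
    (x ^ p) ^ (p ℕ.^ a) + (y ^ p) ^ (p ℕ.^ a) ≡⟨ cong₂ _+_ (^-assocʳ x p _) (^-assocʳ y p _) ⟩
    x ^ (p ℕ.* p ℕ.^ a) + y ^ (p ℕ.* p ℕ.^ a) ∎

-- The subfield 𝔽q

module FixedField (𝕂 : FiniteField) (q n : ℕ) (2≤q : 2 ≤ q) (1≤n : 1 ≤ n)
                  (card≡q^n : FiniteField.card 𝕂 ≡ q ℕ.^ n) where
  open Field 𝕂
  open Characteristic 𝕂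
  open ≡-Reasoning

  module Kₚ = Span 𝕂 q field-as-space 𝔽ₚ

  card≡p^ : ∃ λ e → card ≡ p ℕ.^ e
  card≡p^ with Kₚ.enumerable⇒HasDim {T = λ _ → ⊤} elements (All.tabulate λ _ → tt) (λ {x} _ → elements-complete x)
  ... | e , b , _ , b-indep , b-spans = e , (begin
    card                       ≡⟨ unique∧set⇒length≡ elements-unique (Kₚ.spanList-unique b-indep)
                                    (λ {x} _ → Kₚ.∈⟨⟩⇒∈spanList (b-spans x tt))
                                    (λ {x} _ → elements-complete x) ⟩
    length (Kₚ.spanList b)     ≡⟨ Kₚ.length-spanList b ⟩
    Kₚ.Q ℕ.^ e                 ≡⟨ cong (ℕ._^ e) (trans (length-map ι (upTo p)) (length-upTo p)) ⟩
    p ℕ.^ e                    ∎)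

  q≡p^ : ∃ λ a → q ≡ p ℕ.^ a
  q≡p^ with card≡p^
  ... | e , card≡p^e = ∣-prime-power p-prime e q (subst (q ∣_) (trans (sym card≡q^n) card≡p^e) (q∣q^ n 1≤n))
    where
    q∣q^ : ∀ m → 1 ≤ m → q ∣ q ℕ.^ m
    q∣q^ (suc m) _ = divides (q ℕ.^ m) (ℕ.*-comm q _)

  frobenius-q^ : ∀ i x y → (x + y) ^ (q ℕ.^ i) ≡ x ^ (q ℕ.^ i) + y ^ (q ℕ.^ i)
  frobenius-q^ i x y with q≡p^
  ... | a , q≡p^a = subst (λ m → (x + y) ^ m ≡ x ^ m + y ^ m)
    (sym (trans (cong (ℕ._^ i) q≡p^a) (ℕ.^-*-assoc p a i))) (frobenius-p^ (a ℕ.* i) x y)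

  frobenius-q : ∀ x y → (x + y) ^ q ≡ x ^ q + y ^ q
  frobenius-q x y = subst (λ m → (x + y) ^ m ≡ x ^ m + y ^ m) (ℕ.*-identityʳ q) (frobenius-q^ 1 x y)

  ^ᴷ≡^ : ∀ x m → _^ᴷ_ 𝕂 q x m ≡ x ^ m
  ^ᴷ≡^ x zero    = refl
  ^ᴷ≡^ x (suc m) = cong (x *_) (^ᴷ≡^ x m)

  IsFq⇒^q≡ : ∀ {x} → IsFq 𝕂 q x → x ^ q ≡ x
  IsFq⇒^q≡ {x} = trans (sym (^ᴷ≡^ x q))

  ^q≡⇒IsFq : ∀ {x} → x ^ q ≡ x → IsFq 𝕂 q x
  ^q≡⇒IsFq {x} = trans (^ᴷ≡^ x q)

  0^q≡0 : 0# ^ q ≡ 0#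
  0^q≡0 = subst (λ m → 0# ^ m ≡ 0#) (ℕ.suc-pred q {{ℕ.>-nonZero (ℕ.<-trans (s≤s z≤n) 2≤q)}}) (zeroˡ _)

  1^m≡1 : ∀ m → 1# ^ m ≡ 1#
  1^m≡1 zero    = refl
  1^m≡1 (suc m) = trans (*-identityˡ _) (1^m≡1 m)

  -x^q≡-[x^q] : ∀ x → (- x) ^ q ≡ - (x ^ q)
  -x^q≡-[x^q] x = +-inverseʳ-unique (x ^ q) ((- x) ^ q)
    (trans (sym (frobenius-q x (- x))) (trans (cong (_^ q) (-‿inverseʳ x)) 0^q≡0))

  inverse-fixed : ∀ {x y} → x ^ q ≡ x → x * y ≡ 1# → y ^ q ≡ y
  inverse-fixed {x} {y} x^q≡x xy≡1 = begin
    y ^ q                 ≡⟨ sym (*-identityˡ _) ⟩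
    1# * y ^ q            ≡⟨ cong (_* y ^ q) (trans (sym xy≡1) (*-comm x y)) ⟩
    (y * x) * y ^ q       ≡⟨ *-assoc y x _ ⟩
    y * (x * y ^ q)       ≡⟨ cong (λ t → y * (t * y ^ q)) (sym x^q≡x) ⟩
    y * (x ^ q * y ^ q)   ≡⟨ cong (y *_) (sym (^-distrib-* x y q)) ⟩
    y * (x * y) ^ q       ≡⟨ cong (λ t → y * t ^ q) xy≡1 ⟩
    y * 1# ^ q            ≡⟨ cong (y *_) (1^m≡1 q) ⟩
    y * 1#                ≡⟨ *-identityʳ y ⟩
    y                     ∎

  IsFq? : ∀ x → Dec (IsFq 𝕂 q x)
  IsFq? x = _^ᴷ_ 𝕂 q x q ≟ x

  𝔽q : Subfield
  𝔽q = record
    { IsScalar  = IsFq 𝕂 q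
    ; 0-scalar  = ^q≡⇒IsFq 0^q≡0
    ; 1-scalar  = ^q≡⇒IsFq (1^m≡1 q)
    ; +-scalar  = λ {x} {y} x∈ y∈ →
                    ^q≡⇒IsFq (trans (frobenius-q x y) (cong₂ _+_ (IsFq⇒^q≡ x∈) (IsFq⇒^q≡ y∈)))
    ; *-scalar  = λ {x} {y} x∈ y∈ →
                    ^q≡⇒IsFq (trans (^-distrib-* x y q) (cong₂ _*_ (IsFq⇒^q≡ x∈) (IsFq⇒^q≡ y∈)))
    ; -‿scalar  = λ {x} x∈ → ^q≡⇒IsFq (trans (-x^q≡-[x^q] x) (cong -_ (IsFq⇒^q≡ x∈)))
    ; ⁻¹-scalar = λ {x} x∈ x≢0 → let y , xy≡1 = inverse x x≢0 in
                    y , ^q≡⇒IsFq (inverse-fixed (IsFq⇒^q≡ x∈) xy≡1) , xy≡1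
    ; scalars          = filter IsFq? elements
    ; scalars-unique   = filter⁺ IsFq? elements-unique
    ; scalars-sound    = All.tabulate λ x∈ → proj₂ (∈-filter⁻ IsFq? {xs = elements} x∈)
    ; scalars-complete = λ {x} x∈ → ∈-filter⁺ IsFq? (elements-complete x) x∈
    }

  fixed-by-q^ : ∀ {c} → IsFq 𝕂 q c → ∀ i → c ^ (q ℕ.^ i) ≡ c
  fixed-by-q^ {c} c∈ zero    = *-identityʳ c
  fixed-by-q^ {c} c∈ (suc i) = begin
    c ^ (q ℕ.* q ℕ.^ i)    ≡⟨ sym (^-assocʳ c q _) ⟩
    (c ^ q) ^ (q ℕ.^ i)    ≡⟨ cong (_^ (q ℕ.^ i)) (IsFq⇒^q≡ c∈) ⟩
    c ^ (q ℕ.^ i)          ≡⟨ fixed-by-q^ c∈ i ⟩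
    c                      ∎

-- Coordinate vectors and normalised representatives

module Vectors (𝕂 : FiniteField) (q : ℕ) where
  open Field 𝕂
  open CommutativeRing ring using (+-commutativeSemigroup; *-commutativeSemigroup)
  open import Algebra.Properties.CommutativeSemigroup +-commutativeSemigroup using (interchange)
  open import Algebra.Properties.CommutativeSemigroup *-commutativeSemigroup using (x∙yz≈y∙xz)
  open ≡-Reasoning

  infixl 6 _+ᵛ_
  infixr 7 _·ᵛ_

  _+ᵛ_ : ∀ {m} → Vec K m → Vec K m → Vec K m
  _+ᵛ_ = _+ᵥ_ 𝕂 q

  0ᵛ : ∀ {m} → Vec K m
  0ᵛ = 0ᵥ 𝕂 q

  _·ᵛ_ : ∀ {m} → K → Vec K m → Vec K m
  _·ᵛ_ = _·ᵥ_ 𝕂 q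

  ·ᵛ-distribˡ : ∀ {m} a (x y : Vec K m) → a ·ᵛ (x +ᵛ y) ≡ a ·ᵛ x +ᵛ a ·ᵛ y
  ·ᵛ-distribˡ a []      []      = refl
  ·ᵛ-distribˡ a (b ∷ x) (c ∷ y) = cong₂ _∷_ (distribˡ a b c) (·ᵛ-distribˡ a x y)

  ·ᵛ-distribʳ : ∀ {m} a b (x : Vec K m) → (a + b) ·ᵛ x ≡ a ·ᵛ x +ᵛ b ·ᵛ x
  ·ᵛ-distribʳ a b []      = refl
  ·ᵛ-distribʳ a b (c ∷ x) = cong₂ _∷_ (distribʳ c a b) (·ᵛ-distribʳ a b x)

  Kᵐ : ℕ → VectorSpace
  Kᵐ m = record
    { A = Vec K m ; _⊕_ = _+ᵛ_ ; o = 0ᵛ ; _·_ = _·ᵛ_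
    ; ⊕-assoc     = Vec.zipWith-assoc +-assoc
    ; ⊕-comm      = Vec.zipWith-comm +-comm
    ; ⊕-identityˡ = Vec.zipWith-identityˡ +-identityˡ
    ; ·-distribˡ  = ·ᵛ-distribˡ
    ; ·-distribʳ  = ·ᵛ-distribʳ
    ; ·-assoc     = λ a b x → trans (Vec.map-cong (*-assoc a b) x) (Vec.map-∘ (a *_) (b *_) x)
    ; ·-identityˡ = λ x → trans (Vec.map-cong *-identityˡ x) (Vec.map-id x)
    ; ·-zeroˡ     = λ x → trans (Vec.map-cong zeroˡ x) (Vec.map-const x 0#)
    ; _≟ᵥ_        = Vec.≡-dec _≟_
    }

  dot-+ʳ : ∀ {m} (l x y : Vec K m) → dot 𝕂 q l (x +ᵛ y) ≡ dot 𝕂 q l x + dot 𝕂 q l y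
  dot-+ʳ []      []      []      = sym (+-identityˡ 0#)
  dot-+ʳ (a ∷ l) (b ∷ x) (c ∷ y) =
    trans (cong₂ _+_ (distribˡ a b c) (dot-+ʳ l x y)) (interchange (a * b) (a * c) _ _)

  dot-·ʳ : ∀ {m} (l : Vec K m) a x → dot 𝕂 q l (a ·ᵛ x) ≡ a * dot 𝕂 q l x
  dot-·ʳ []      a []      = sym (zeroʳ a)
  dot-·ʳ (b ∷ l) a (c ∷ x) = trans (cong₂ _+_ (x∙yz≈y∙xz b a c) (dot-·ʳ l a x)) (sym (distribˡ a _ _))

  dot-·ˡ : ∀ {m} (l : Vec K m) a x → dot 𝕂 q (a ·ᵛ l) x ≡ a * dot 𝕂 q l x
  dot-·ˡ []      a []      = sym (zeroʳ a)
  dot-·ˡ (b ∷ l) a (c ∷ x) = trans (cong₂ _+_ (*-assoc a b c) (dot-·ˡ l a x)) (sym (distribˡ a _ _))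

  normaliser : ∀ {m} → Vec K m → K
  normaliser []      = 1#
  normaliser (x ∷ v) with x ≟ 0#
  ... | yes _   = normaliser v
  ... | no x≢0 = proj₁ (inverse x x≢0)

  normaliser-nonzero : ∀ {m} (v : Vec K m) → normaliser v ≢ 0#
  normaliser-nonzero []      = 0≢1 ∘ sym
  normaliser-nonzero (x ∷ v) with x ≟ 0#
  ... | yes _   = normaliser-nonzero v
  ... | no x≢0 = λ x⁻¹≡0 →
    0≢1 (trans (sym (zeroʳ x)) (trans (cong (x *_) (sym x⁻¹≡0)) (proj₂ (inverse x x≢0))))

  normalise : ∀ {m} → Vec K m → Vec K m
  normalise v = normaliser v ·ᵛ v

  normalise-Normalized : ∀ {m} (v : Vec K m) → v ≢ 0ᵛ → Normalized 𝕂 q (normalise v)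
  normalise-Normalized []      v≢0 = v≢0 refl
  normalise-Normalized (x ∷ v) v≢0 with x ≟ 0#
  ... | yes x≡0 =
    inj₂ (trans (cong (normaliser v *_) x≡0) (zeroʳ _) , normalise-Normalized v (v≢0 ∘ cong₂ _∷_ x≡0))
  ... | no x≢0 = inj₁ (trans (*-comm _ x) (proj₂ (inverse x x≢0)))

  Normalized⇒≢0ᵛ : ∀ {m} {v : Vec K m} → Normalized 𝕂 q v → v ≢ 0ᵛ
  Normalized⇒≢0ᵛ {v = x ∷ v} (inj₁ x≡1)      v≡0 = 0≢1 (trans (sym (Vec.∷-injectiveˡ v≡0)) x≡1)
  Normalized⇒≢0ᵛ {v = x ∷ v} (inj₂ (_ , nv)) v≡0 = Normalized⇒≢0ᵛ nv (Vec.∷-injectiveʳ v≡0)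

  Normalized-multiple⇒1 : ∀ {m} a (v : Vec K m) → Normalized 𝕂 q v → Normalized 𝕂 q (a ·ᵛ v) → a ≡ 1#
  Normalized-multiple⇒1 a (x ∷ v) (inj₁ x≡1) (inj₁ ax≡1) =
    trans (sym (*-identityʳ a)) (trans (cong (a *_) (sym x≡1)) ax≡1)
  Normalized-multiple⇒1 a (x ∷ v) (inj₁ x≡1) (inj₂ (ax≡0 , nav)) = ⊥-elim (Normalized⇒≢0ᵛ nav (begin
    a ·ᵛ v    ≡⟨ cong (_·ᵛ v) (trans (sym (*-identityʳ a)) (trans (cong (a *_) (sym x≡1)) ax≡0)) ⟩
    0# ·ᵛ v   ≡⟨ VectorSpace.·-zeroˡ (Kᵐ _) v ⟩
    0ᵛ        ∎))
  Normalized-multiple⇒1 a (x ∷ v) (inj₂ (x≡0 , _)) (inj₁ ax≡1) =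
    ⊥-elim (0≢1 (trans (sym (zeroʳ a)) (trans (cong (a *_) (sym x≡0)) ax≡1)))
  Normalized-multiple⇒1 a (x ∷ v) (inj₂ (_ , nv)) (inj₂ (_ , nav)) = Normalized-multiple⇒1 a v nv nav

  Normalized-multiple⇒≡ : ∀ {m} a {u v : Vec K m} →
    Normalized 𝕂 q u → Normalized 𝕂 q v → v ≡ a ·ᵛ u → v ≡ u
  Normalized-multiple⇒≡ a {u} nu nv v≡au = trans v≡au (trans
    (cong (_·ᵛ u) (Normalized-multiple⇒1 a u nu (subst (Normalized 𝕂 q) v≡au nv)))
    (VectorSpace.·-identityˡ (Kᵐ _) u))

-- Linearised polynomials, weights and ranks

module LinearisedPolynomials (𝕂 : FiniteField) (q n : ℕ) (2≤q : 2 ≤ q) (1≤n : 1 ≤ n)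
                             (card≡q^n : FiniteField.card 𝕂 ≡ q ℕ.^ n) where
  open Field 𝕂
  open Characteristic 𝕂 using (_^_; ^-distrib-*)
  open FixedField 𝕂 q n 2≤q 1≤n card≡q^n
  open Vectors 𝕂 q
  open CommutativeRing ring using (*-commutativeSemigroup)
  open import Algebra.Properties.CommutativeSemigroup *-commutativeSemigroup using (x∙yz≈y∙xz)
  module Kq = Span 𝕂 q field-as-space 𝔽q
  module Kⁿ = Span 𝕂 q (Kᵐ n) K-as-subfield
  open ≡-Reasoning

  conjugate : K → Fin n → K
  conjugate x i = _^ᴷ_ 𝕂 q x (q ℕ.^ toℕ i)

  conjugate-+ : ∀ x y i → conjugate (x + y) i ≡ conjugate x i + conjugate y i
  conjugate-+ x y i = begin
    conjugate (x + y) i            ≡⟨ ^ᴷ≡^ (x + y) N ⟩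
    (x + y) ^ N                    ≡⟨ frobenius-q^ (toℕ i) x y ⟩
    x ^ N + y ^ N                  ≡⟨ sym (cong₂ _+_ (^ᴷ≡^ x N) (^ᴷ≡^ y N)) ⟩
    conjugate x i + conjugate y i  ∎
    where N = q ℕ.^ toℕ i

  conjugate-scalar : ∀ {c} x i → IsFq 𝕂 q c → conjugate (c * x) i ≡ c * conjugate x i
  conjugate-scalar {c} x i c∈ = begin
    conjugate (c * x) i    ≡⟨ ^ᴷ≡^ (c * x) N ⟩
    (c * x) ^ N            ≡⟨ ^-distrib-* c x N ⟩
    c ^ N * x ^ N          ≡⟨ cong₂ _*_ (fixed-by-q^ c∈ (toℕ i)) (sym (^ᴷ≡^ x N)) ⟩
    c * conjugate x i      ∎
    where N = q ℕ.^ toℕ i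

  ev-+ : ∀ (g : Vec K n) x y → ev 𝕂 q g (x + y) ≡ ev 𝕂 q g x + ev 𝕂 q g y
  ev-+ g x y = trans (Kq.∑-cong n λ i → trans (cong (lookup g i *_) (conjugate-+ x y i)) (distribˡ _ _ _)) (Kq.∑-⊕ n _ _)

  ev-scalar : ∀ (g : Vec K n) {c} x → IsFq 𝕂 q c → ev 𝕂 q g (c * x) ≡ c * ev 𝕂 q g x
  ev-scalar g {c} x c∈ =
    trans (Kq.∑-cong n λ i → trans (cong (lookup g i *_) (conjugate-scalar x i c∈)) (x∙yz≈y∙xz _ c _))
          (sym (Kq.∑-· n c _))

  ev-+ᵛ : ∀ (u v : Vec K n) x → ev 𝕂 q (u +ᵛ v) x ≡ ev 𝕂 q u x + ev 𝕂 q v x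
  ev-+ᵛ u v x = trans (Kq.∑-cong n λ i → trans (cong (_* conjugate x i) (Vec.lookup-zipWith _+_ i u v)) (distribʳ _ _ _))
    (Kq.∑-⊕ n _ _)

  ev-·ᵛ : ∀ a (u : Vec K n) x → ev 𝕂 q (a ·ᵛ u) x ≡ a * ev 𝕂 q u x
  ev-·ᵛ a u x = trans (Kq.∑-cong n λ i → trans (cong (_* conjugate x i) (Vec.lookup-map i (a *_) u)) (*-assoc a _ _))
    (sym (Kq.∑-· n a _))

  ev-0ᵛ : ∀ x → ev 𝕂 q (0ᵛ {n}) x ≡ 0#
  ev-0ᵛ x = trans (Kq.∑-cong n λ i → trans (cong (_* conjugate x i) (Vec.lookup-replicate i 0#)) (zeroˡ _)) (Kq.∑-o n)

  evaluations : ∀ {k} → Vec (Vec K n) k → K → Vec K k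
  evaluations fs x = Vec.map (λ g → ev 𝕂 q g x) fs

  ev-lincomb : ∀ {k} (λv : Vec K k) (fs : Vec (Vec K n) k) x →
    ev 𝕂 q (Kⁿ.lincomb (lookup λv) (lookup fs)) x ≡ dot 𝕂 q λv (evaluations fs x)
  ev-lincomb []       []       x = ev-0ᵛ x
  ev-lincomb (a ∷ λv) (g ∷ fs) x = trans (ev-+ᵛ (a ·ᵛ g) _ x) (cong₂ _+_ (ev-·ᵛ a g x) (ev-lincomb λv fs x))

  evaluations-+ : ∀ {k} (fs : Vec (Vec K n) k) x y → evaluations fs (x + y) ≡ evaluations fs x +ᵛ evaluations fs y
  evaluations-+ []       x y = refl
  evaluations-+ (g ∷ fs) x y = cong₂ _∷_ (ev-+ g x y) (evaluations-+ fs x y)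

  evaluations-scalar : ∀ {k} (fs : Vec (Vec K n) k) {c} x → IsFq 𝕂 q c →
    evaluations fs (c * x) ≡ c ·ᵛ evaluations fs x
  evaluations-scalar []       x c∈ = refl
  evaluations-scalar (g ∷ fs) x c∈ = cong₂ _∷_ (ev-scalar g x c∈) (evaluations-scalar fs x c∈)

  ev-0 : ∀ (g : Vec K n) → ev 𝕂 q g 0# ≡ 0#
  ev-0 g = begin
    ev 𝕂 q g 0#            ≡⟨ cong (ev 𝕂 q g) (sym (zeroˡ 0#)) ⟩
    ev 𝕂 q g (0# * 0#)     ≡⟨ ev-scalar g 0# (Subfield.0-scalar 𝔽q) ⟩
    0# * ev 𝕂 q g 0#       ≡⟨ zeroˡ _ ⟩
    0#                     ∎

  evaluations-0 : ∀ {k} (fs : Vec (Vec K n) k) → evaluations fs 0# ≡ 0ᵛ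
  evaluations-0 []       = refl
  evaluations-0 (g ∷ fs) = cong₂ _∷_ (ev-0 g) (evaluations-0 fs)

  evaluations-lincomb : ∀ {k d} (fs : Vec (Vec K n) k) (c : Fin d → K) xs → Kq.Scalars c →
    evaluations fs (Kq.lincomb c xs) ≡ Span.lincomb 𝕂 q (Kᵐ k) 𝔽q c (evaluations fs ∘ xs)
  evaluations-lincomb {d = zero}  fs c xs c∈ = evaluations-0 fs
  evaluations-lincomb {d = suc d} fs c xs c∈ = trans (evaluations-+ fs _ _)
    (cong₂ _+ᵛ_ (evaluations-scalar fs (xs zero) (c∈ zero)) (evaluations-lincomb fs (c ∘ suc) (xs ∘ suc) (c∈ ∘ suc)))

module WeightsAndRanks (𝕂 : FiniteField) (q n : ℕ) (2≤q : 2 ≤ q) (1≤n : 1 ≤ n)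
                       (card≡q^n : FiniteField.card 𝕂 ≡ q ℕ.^ n)
                       {k : ℕ} (f : Vec (Vec (FiniteField.K 𝕂) n) k) where
  open Field 𝕂
  open FixedField 𝕂 q n 2≤q 1≤n card≡q^n using (𝔽q)
  open LinearisedPolynomials 𝕂 q n 2≤q 1≤n card≡q^n
  open Vectors 𝕂 q
  module Kᵏ = Span 𝕂 q (Kᵐ k) 𝔽q

  U-subspace : Kᵏ.Subspace (U 𝕂 q f)
  U-subspace c xs c∈ xs∈U = Kq.lincomb c (proj₁ ∘ xs∈U) ,
    trans (evaluations-lincomb f c _ c∈) (Kᵏ.lincomb-cong (λ _ → refl) (proj₂ ∘ xs∈U))

  combination : Vec K k → Vec K n
  combination λv = Kⁿ.lincomb (lookup λv) (lookup f)

  module _ (U-dim : FqDimV 𝕂 q (U 𝕂 q f) n) (λv : Vec K k) where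
    open RankNullity 𝕂 q 𝔽q (Kᵐ k) field-as-space
    open OnSubspace (dot 𝕂 q λv) (dot-+ʳ λv) (dot-·ʳ λv) U-subspace U-dim

    image-of-combination⇒Im : ∀ {y} → (∃ λ x → ev 𝕂 q (combination λv) x ≡ y) → Im y
    image-of-combination⇒Im (x , eq) = evaluations f x , (x , refl) , trans (sym (ev-lincomb λv f x)) eq

    Im⇒image-of-combination : ∀ {y} → Im y → ∃ λ x → ev 𝕂 q (combination λv) x ≡ y
    Im⇒image-of-combination (_ , (x , refl) , eq) = x , trans (ev-lincomb λv f x) eq

    weight⇒rank : ∀ {w} → FqDimV 𝕂 q (UcapHyp 𝕂 q f λv) w → Rank 𝕂 q (combination λv) (n ∸ w)
    weight⇒rank weight = Kq.HasDim-resp Im⇒image-of-combination image-of-combination⇒Im (dim-Ker⇒dim-Im weight)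

    rank⇒weight : ∀ {r} → Rank 𝕂 q (combination λv) r → FqDimV 𝕂 q (UcapHyp 𝕂 q f λv) (n ∸ r)
    rank⇒weight rank = dim-Im⇒dim-Ker (Kq.HasDim-resp image-of-combination⇒Im Im⇒image-of-combination rank)

-- Hyperplanes and points of Ω(𝒞)

module Duality (𝕂 : FiniteField) (q n : ℕ) (2≤q : 2 ≤ q) (1≤n : 1 ≤ n)
               (card≡q^n : FiniteField.card 𝕂 ≡ q ℕ.^ n)
               {k : ℕ} (f : Vec (Vec (FiniteField.K 𝕂) n) k) (f-indep : KLinIndep 𝕂 q f)
               (U-dim : FqDimV 𝕂 q (U 𝕂 q f) n) (i : ℕ) (i≤n : i ≤ n) where
  open Field 𝕂
  open LinearisedPolynomials 𝕂 q n 2≤q 1≤n card≡q^n using (module Kⁿ)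
  open WeightsAndRanks 𝕂 q n 2≤q 1≤n card≡q^n f
  open Vectors 𝕂 q
  open ≡-Reasoning

  combination-injective : ∀ {λv μ} → combination λv ≡ combination μ → λv ≡ μ
  combination-injective eq = lookup-extensionality
    (Kⁿ.independent⇒coefficients-unique (λ c _ → f-indep c) (λ _ → tt) (λ _ → tt) eq)

  combination-· : ∀ a λv → combination (a ·ᵛ λv) ≡ a ·ᵛ combination λv
  combination-· a λv = trans (Kⁿ.lincomb-cong (λ j → Vec.lookup-map j (a *_) λv) (λ _ → refl))
    (sym (Kⁿ.lincomb-scale a (lookup λv) (lookup f)))

  combination-0 : combination 0ᵛ ≡ 0ᵛ
  combination-0 = trans (Kⁿ.lincomb-cong {k} (λ j → Vec.lookup-replicate j 0#) (λ _ → refl))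
                        (Kⁿ.lincomb-zeroˡ (lookup f))

  combination-nonzero : ∀ {λv} → λv ≢ 0ᵛ → combination λv ≢ 0ᵛ
  combination-nonzero λv≢0 eq = λv≢0 (combination-injective (trans eq (sym combination-0)))

  -- 0ᵛ is a junk value for g outside the span of f.
  coordinates : Vec K n → Vec K k
  coordinates g with g Kⁿ.∈⟨ lookup f ⟩?
  ... | yes (c , _ , _) = tabulate c
  ... | no _            = 0ᵛ

  combination∘coordinates : ∀ {g} → InSpan 𝕂 q f g → combination (coordinates g) ≡ g
  combination∘coordinates {g} (c , eq) with g Kⁿ.∈⟨ lookup f ⟩?
  ... | yes (c′ , _ , eq′) = trans (Kⁿ.lincomb-cong (Vec.lookup∘tabulate c′) (λ _ → refl)) eq′
  ... | no g∉             = ⊥-elim (g∉ (c , (λ _ → tt) , eq))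

  coordinates∘combination : ∀ λv → coordinates (combination λv) ≡ λv
  coordinates∘combination λv = combination-injective (combination∘coordinates (lookup λv , refl))

  UcapHyp-scale : ∀ {a λv w} → a ≢ 0# →
    FqDimV 𝕂 q (UcapHyp 𝕂 q f λv) w → FqDimV 𝕂 q (UcapHyp 𝕂 q f (a ·ᵛ λv)) w
  UcapHyp-scale {a} {λv} a≢0 = Kᵏ.HasDim-resp
    (λ { (u∈U , λu≡0) → u∈U , trans (dot-·ˡ λv a _) (trans (cong (a *_) λu≡0) (zeroʳ a)) })
    (λ { (u∈U , aλu≡0) → u∈U , second-factor≡0 (trans (sym (dot-·ˡ λv a _)) aλu≡0) })
    where
    second-factor≡0 : ∀ {t} → a * t ≡ 0# → t ≡ 0#
    second-factor≡0 at≡0 with x*y≡0⇒x≡0⊎y≡0 at≡0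
    ... | inj₁ a≡0 = ⊥-elim (a≢0 a≡0)
    ... | inj₂ t≡0 = t≡0

  Hyperplane : Vec K k → Set
  Hyperplane = HyperplaneOfWeight 𝕂 q f (n ∸ i)

  Point : Vec K n → Set
  Point = OmegaPointOfRank 𝕂 q f i

  toPoint : Vec K k → Vec K n
  toPoint λv = normalise (combination λv)

  toHyperplane : Vec K n → Vec K k
  toHyperplane g = normalise (coordinates g)

  toPoint-Point : ∀ {λv} → Hyperplane λv → Point (toPoint λv)
  toPoint-Point {λv} (λv-normalized , weight) =
    normalise-Normalized _ (combination-nonzero (Normalized⇒≢0ᵛ λv-normalized)) ,
    subst (InSpan 𝕂 q f) (combination-· a λv) (lookup (a ·ᵛ λv) , refl) ,
    subst (λ g → Rank 𝕂 q g i) (combination-· a λv)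
      (subst (Rank 𝕂 q (combination (a ·ᵛ λv))) (ℕ.m∸[m∸n]≡n i≤n) rank)
    where
    a = normaliser (combination λv)
    rank : Rank 𝕂 q (combination (a ·ᵛ λv)) (n ∸ (n ∸ i))
    rank = weight⇒rank U-dim (a ·ᵛ λv) (UcapHyp-scale {λv = λv} (normaliser-nonzero (combination λv)) weight)

  toHyperplane-Hyperplane : ∀ {g} → Point g → Hyperplane (toHyperplane g)
  toHyperplane-Hyperplane {g} (g-normalized , g∈span , rank) =
    normalise-Normalized μ μ≢0 ,
    UcapHyp-scale {λv = μ} (normaliser-nonzero μ) (rank⇒weight U-dim μ (subst (λ t → Rank 𝕂 q t i) (sym μ↦g) rank))
    where
    μ = coordinates g
    μ↦g = combination∘coordinates g∈span
    μ≢0 : μ ≢ 0ᵛ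
    μ≢0 μ≡0 = Normalized⇒≢0ᵛ g-normalized (trans (sym μ↦g) (trans (cong combination μ≡0) combination-0))

  toPoint∘toHyperplane : ∀ {g} → Point g → toPoint (toHyperplane g) ≡ g
  toPoint∘toHyperplane {g} pt@(g-normalized , g∈span , _) =
    Normalized-multiple⇒≡ (a * b) g-normalized (proj₁ (toPoint-Point (toHyperplane-Hyperplane pt))) (begin
      a ·ᵛ combination (b ·ᵛ μ)   ≡⟨ cong (a ·ᵛ_) (combination-· b μ) ⟩
      a ·ᵛ (b ·ᵛ combination μ)   ≡⟨ cong (λ t → a ·ᵛ (b ·ᵛ t)) (combination∘coordinates g∈span) ⟩
      a ·ᵛ (b ·ᵛ g)               ≡⟨ sym (Kⁿ.·-assoc a b g) ⟩
      (a * b) ·ᵛ g                ∎)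
    where
    μ = coordinates g
    b = normaliser μ
    a = normaliser (combination (b ·ᵛ μ))

  toHyperplane∘toPoint : ∀ {λv} → Hyperplane λv → toHyperplane (toPoint λv) ≡ λv
  toHyperplane∘toPoint {λv} hyp@(λv-normalized , _) =
    Normalized-multiple⇒≡ (b * a) λv-normalized (proj₁ (toHyperplane-Hyperplane (toPoint-Point hyp))) (begin
      b ·ᵛ coordinates (a ·ᵛ combination λv)   ≡⟨ cong (λ t → b ·ᵛ coordinates t) (sym (combination-· a λv)) ⟩
      b ·ᵛ coordinates (combination (a ·ᵛ λv)) ≡⟨ cong (b ·ᵛ_) (coordinates∘combination (a ·ᵛ λv)) ⟩
      b ·ᵛ (a ·ᵛ λv)                           ≡⟨ sym (Kᵏ.·-assoc b a λv) ⟩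
      (b * a) ·ᵛ λv                            ∎)
    where
    a = normaliser (combination λv)
    b = normaliser (coordinates (toPoint λv))

-- Imported only here: inside the development _^_ is exponentiation in 𝕂.
open import Data.Nat using (_^_)

mainTheorem10 : (𝕂 : FiniteField) (q n k : ℕ) → 2 ≤ q → 1 ≤ n
    → FiniteField.card 𝕂 ≡ q ^ n
    → (f : Vec (Vec (FiniteField.K 𝕂) n) k)
    → KLinIndep 𝕂 q f
    → FqDimV 𝕂 q (U 𝕂 q f) n
    → (i : ℕ) → i ≤ n → (m : ℕ)
    → HasCount (HyperplaneOfWeight 𝕂 q f (n ∸ i)) m
      ⇔ HasCount (OmegaPointOfRank 𝕂 q f i) m
mainTheorem10 𝕂 q n k 2≤q 1≤n card≡q^n f f-indep U-dim i i≤n m = mk⇔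
  (HasCount-transport toPoint toHyperplane toPoint-Point toHyperplane-Hyperplane toHyperplane∘toPoint toPoint∘toHyperplane)
  (HasCount-transport toHyperplane toPoint toHyperplane-Hyperplane toPoint-Point toPoint∘toHyperplane toHyperplane∘toPoint)
  where open Duality 𝕂 q n 2≤q 1≤n card≡q^n f f-indep U-dim i i≤n
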